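{- Let $m\geq0$ and $n\geq1$ be integers. For every $c\in\mathcal{C}_{n,m}$ with $\tilde\rho(c)=c$, the generalized domino array $\Omega_{n,m}(c)$ belongs to $\mathcal{G}_{n,m}$, and $\Omega_{n,m}$ is a bijection from $\{c\in\mathcal{C}_{n,m}:\tilde\rho(c)=c\}$ onto $\mathcal{G}_{n,m}$.
   Context: $\mathcal{C}_{n,m}$: column-strict plane partitions $c$ (positive entries, partition shape, weakly decreasing along rows, strictly decreasing down columns) with at most $n$ columns and every part in column $j$ at most $n+m-j$. For $2\leq r\leq n+m$, $\beta_r$ is the twisted Bender–Knuth involution: ignore each column containing both an $r$ and an $r-1$, and ignore an entry $r-1$ lying in column $n+m-r+1$ (saturated $r-1$); in each row the remaining entries equal to $r$ or $r-1$ are $k$ $r$'s followed by $l$ $(r-1)$'s; replace them by $l$ $r$'s followed by $k$ $(r-1)$'s. $\tilde\rho=\beta_2\beta_4\cdots$, product over all $\beta_i$ with $i$ even and $i\leq n$. For $c$ with $\tilde\rho(c)=c$ and each $r\geq1$: an entry $2r$ and an entry $2r-1$ in the same column (necessarily in adjacent rows) are called paired; an entry $2r-1$ in column $n+m-2r+1$ is saturated; all other entries equal to $2r$ or $2r-1$ are free, and invariance forces each row to contain $k$ free $2r$'s immediately followed by $k$ free $(2r-1)$'s for some $k$. $\Omega_{n,m}(c)$ is obtained by replacing, for every $r\ge1$, each paired $2r,2r-1$ by a vertical domino labelled $r$, the $2k$ cells of free $2r$'s and $(2r-1)$'s in each row by $k$ horizontal dominoes labelled $r$, and each saturated $2r-1$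 by a single $1\times1$ square labelled $r$. A column-strict generalized domino plane partition of shape $\lambda$ is a tiling of the Young diagram of $\lambda$ by $1\times1$ squares and dominoes ($1\times2$ or $2\times1$), each tile labelled by a positive integer (a part), with labels weakly decreasing along rows and strictly decreasing down columns; a part is in column $j$ if its tile meets column $j$; a part in a $1\times1$ square is a single part. $\mathcal{G}_{n,m}$ is the set of such objects with (E1) at most $n$ columns, (E2) every part in column $j$ at most $\lceil (n+m-j)/2\rceil$, (E3) a part in column $j$ equal to $\lceil(n+m-j)/2\rceil$ with $n+m-j$ odd is a single part, and every single part lies in a column $j$ with $n+m-j$ odd and equals $\lceil(n+m-j)/2\rceil$. -}

module Defs where

open import Data.Nat.Base using (ℕ; zero; suc; _+_; _*_; _∸_; _<_; _≤_; _/_; _%_; ⌈_/2⌉; _≡ᵇ_; _<ᵇ_)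
open import Data.Bool.Base using (Bool; true; false; if_then_else_; _∧_; _∨_; not)
open import Data.List.Base using (List; []; _∷_; length; map; upTo; foldr)
open import Data.Bool.ListAction using (any)
open import Data.Maybe.Base using (Maybe; just; nothing; fromMaybe; maybe)
open import Data.Product.Base using (_×_; _,_)
open import Function.Base using (id; _∘_)
open import Relation.Binary.PropositionalEquality using (_≡_; _≢_)
open import Data.List.Relation.Unary.All using (All)
open import Data.Product.Base using (∃)

-- Arrays: a list of rows (row i, 0-indexed), each row a list of entries
-- (column j, 0-indexed; the paper's column number is j + 1).

nth : {A : Set} → List A → ℕ → Maybe A
nth []       _       = nothing
nth (x ∷ xs) zero    = just x
nth (x ∷ xs) (suc k) = nth xs k

at : {A : Set} → List (List A) → ℕ → ℕ → Maybe A
at a i j = maybe (λ row → nth row j) nothing (nth a i)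

countBelow : (ℕ → Bool) → ℕ → ℕ
countBelow p zero    = 0
countBelow p (suc j) = countBelow p j + (if p j then 1 else 0)

isJust≡ : Maybe ℕ → ℕ → Bool
isJust≡ (just x) v = x ≡ᵇ v
isJust≡ nothing  v = false

PP : Set
PP = List (List ℕ)

val : PP → ℕ → ℕ → ℕ
val c i j = fromMaybe 0 (at c i j)

colHas : PP → ℕ → ℕ → Bool
colHas c j v = any (λ row → isJust≡ (nth row j) v) c

record InC (n m : ℕ) (c : PP) : Set where
  field
    -- partition shape: no empty rows, rows left-justified (lists),
    -- row lengths weakly decreasing
    rowsNonempty : All (λ row → 0 < length row) c
    shape        : ∀ i j x → at c (suc i) j ≡ just x → ∃ λ y → at c i j ≡ just y
    positive     : ∀ i j x → at c i j ≡ just x → 0 < x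
    rowWeak      : ∀ i j x y → at c i j ≡ just x → at c i (suc j) ≡ just y → y ≤ x
    colStrict    : ∀ i j x y → at c i j ≡ just x → at c (suc i) j ≡ just y → y < x
    columns      : ∀ i j x → at c i j ≡ just x → suc j ≤ n
    bound        : ∀ i j x → at c i j ≡ just x → x ≤ n + m ∸ suc j

βfree : ℕ → ℕ → ℕ → PP → ℕ → ℕ → Bool
βfree n m r c i j with at c i j
... | nothing = false
... | just v  =
  ((v ≡ᵇ r) ∨ (v ≡ᵇ (r ∸ 1)))
  ∧ not (colHas c j r ∧ colHas c j (r ∸ 1))
  -- saturated r-1: entry r-1 in column n+m-r+1, i.e. (j+1) + (r-1) = n+m
  ∧ not ((v ≡ᵇ (r ∸ 1)) ∧ ((suc j + v) ≡ᵇ (n + m)))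

β : ℕ → ℕ → ℕ → PP → PP
β n m r c = map row (upTo (length c))
  where
  row : ℕ → List ℕ
  row i = map cell (upTo (length (fromMaybe [] (nth c i))))
    where
    fr : ℕ → Bool
    fr = βfree n m r c i
    len : ℕ
    len = length (fromMaybe [] (nth c i))
    l : ℕ
    l = countBelow (λ k → fr k ∧ (val c i k ≡ᵇ (r ∸ 1))) len
    cell : ℕ → ℕ
    cell j = if fr j
             then (if countBelow fr j <ᵇ l then r else r ∸ 1)
             else val c i j

evensUpTo : ℕ → List ℕ
evensUpTo k = map (λ i → 2 * suc i) (upTo (k / 2))

ρ̃ : ℕ → ℕ → PP → PP
ρ̃ n m = foldr (λ r f → β n m r ∘ f) id (evensUpTo (n + m))

-- Generalized domino arrays: each cell records which part of which kind
-- of tile it is, together with the tile's label.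

data Tile : Set where
  sq  : Tile   -- 1×1 square (single part)
  hL  : Tile   -- left cell of a horizontal domino
  hR  : Tile   -- right cell of a horizontal domino
  vT  : Tile   -- top cell of a vertical domino
  vB  : Tile   -- bottom cell of a vertical domino

GDA : Set
GDA = List (List (Tile × ℕ))

record InG (n m : ℕ) (g : GDA) : Set where
  field
    rowsNonempty : All (λ row → 0 < length row) g
    shape        : ∀ i j x → at g (suc i) j ≡ just x → ∃ λ y → at g i j ≡ just y
    -- the cell data form a tiling by squares and dominoes, each tile
    -- carrying one label
    hLright : ∀ i j a → at g i j ≡ just (hL , a) → at g i (suc j) ≡ just (hR , a)
    hRleft  : ∀ i j a → at g i (suc j) ≡ just (hR , a) → at g i j ≡ just (hL , a)
    hRnot0  : ∀ i a → at g i 0 ≢ just (hR , a)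
    vTbelow : ∀ i j a → at g i j ≡ just (vT , a) → at g (suc i) j ≡ just (vB , a)
    vBabove : ∀ i j a → at g (suc i) j ≡ just (vB , a) → at g i j ≡ just (vT , a)
    vBnot0  : ∀ j a → at g 0 j ≢ just (vB , a)
    positive : ∀ i j t x → at g i j ≡ just (t , x) → 0 < x
    -- labels weakly decreasing along rows, strictly decreasing down columns
    -- (between different tiles)
    rowWeak   : ∀ i j t u x y → at g i j ≡ just (t , x) → at g i (suc j) ≡ just (u , y) → y ≤ x
    colStrict : ∀ i j t u x y → at g i j ≡ just (t , x) → at g (suc i) j ≡ just (u , y) →
                t ≢ vT → y < x
    E1 : ∀ i j p → at g i j ≡ just p → suc j ≤ n
    E2 : ∀ i j t x → at g i j ≡ just (t , x) → x ≤ ⌈ (n + m ∸ suc j) /2⌉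
    E3a : ∀ i j t x → at g i j ≡ just (t , x) → (n + m ∸ suc j) % 2 ≡ 1 →
          x ≡ ⌈ (n + m ∸ suc j) /2⌉ → t ≡ sq
    E3b : ∀ i j x → at g i j ≡ just (sq , x) →
          ((n + m ∸ suc j) % 2 ≡ 1) × (x ≡ ⌈ (n + m ∸ suc j) /2⌉)

-- entry v = 2r or 2r-1 with r = ⌈v/2⌉; its partner value
partner : ℕ → ℕ
partner v = if v % 2 ≡ᵇ 0 then v ∸ 1 else suc v

ΩpairedAt : PP → ℕ → ℕ → Bool
ΩpairedAt c i j = colHas c j (partner (val c i j))

-- saturated: v = 2r-1 in column n+m-2r+1, i.e. (j+1) + v = n+m
ΩsatAt : ℕ → ℕ → PP → ℕ → ℕ → Bool
ΩsatAt n m c i j = (val c i j % 2 ≡ᵇ 1) ∧ ((suc j + val c i j) ≡ᵇ (n + m))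

ΩfreeAt : ℕ → ℕ → PP → ℕ → ℕ → Bool
ΩfreeAt n m c i j = not (ΩpairedAt c i j) ∧ not (ΩsatAt n m c i j)

Ω : ℕ → ℕ → PP → GDA
Ω n m c = map row (upTo (length c))
  where
  row : ℕ → List (Tile × ℕ)
  row i = map cell (upTo (length (fromMaybe [] (nth c i))))
    where
    cell : ℕ → Tile × ℕ
    cell j =
      let v = val c i j
          r = ⌈ v /2⌉
          p = countBelow (λ k → ΩfreeAt n m c i k ∧ (⌈ val c i k /2⌉ ≡ᵇ r)) j
      in if ΩpairedAt c i j
         then (if v % 2 ≡ᵇ 0 then (vT , r) else (vB , r))
         else if ΩsatAt n m c i j
         then (sq , r)
         else (if p % 2 ≡ᵇ 0 then (hL , r) else (hR , r))

-- For r = 2t + 2 the involution β_r only exchanges entries r and r - 1, and every other β_r′ composed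
-- into ρ̃ neither creates nor moves such entries. Hence ρ̃ c = c exactly when β_{2t+2} c = c whenever
-- 2t + 2 ≤ n + m, that is, when in every row the free entries 2t + 2 come first and are as many as the
-- free entries 2t + 1 after them. Because columns strictly decrease, the free entries with label t + 1 form a single
-- run in each row, so Ω can cut that run into horizontal dominoes, while column pairs 2t + 2 over 2t + 1
-- become vertical dominoes and saturated entries squares; the column bound n + m - j, halved, gives
-- (E2) and (E3). Conversely Ψ reads a tile labelled s back as 2s or 2s - 1 (for a horizontal domino,
-- according to the half of its run it lies in). Ψ lands in the fixed points of ρ̃ in C_{n,m}, and
-- Ω ∘ Ψ and Ψ ∘ Ω are identities, which gives injectivity and surjectivity.

module Submission where

open import Defs
open import Data.Nat.Base
open import Data.Nat.Properties
open import Data.Nat.DivMod using (m*n/n≡m; /-monoˡ-≤)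
open import Data.Bool.Base using (Bool; true; false; if_then_else_; _∧_; _∨_; not; T)
import Data.Bool.Properties as Bool
open import Data.List.Base using (List; []; _∷_; length; map; upTo; foldr; applyUpTo)
open import Data.List.Properties using (map-upTo; length-map; length-upTo; length-applyUpTo)
open import Data.List.Relation.Unary.All using (All; []; _∷_)
open import Data.Maybe.Base as Maybe using (Maybe; just; nothing; fromMaybe)
open import Data.Maybe.Properties using (just-injective)
open import Data.Product.Base using (_×_; _,_; ∃; Σ; proj₁; proj₂)
open import Data.Sum.Base using (_⊎_; inj₁; inj₂)
open import Data.Empty using (⊥-elim)
open import Data.Unit.Base using (tt)
open import Function.Base using (id; _∘_; case_of_)
open import Relation.Binary.PropositionalEquality
open import Relation.Nullary using (¬_; Dec; yes; no; map′)
open import Relation.Binary.Definitions using (tri<; tri≈; tri>)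

rowLength : {A : Set} → List (List A) → ℕ → ℕ
rowLength a i = length (fromMaybe [] (nth a i))

record InShape {A : Set} (a : List (List A)) (i j : ℕ) : Set where
  constructor inShape
  field column< : j < rowLength a i
open InShape

-- β n m r c and Ω n m c are, definitionally, tabulateOn c applied to a cell function.
tabulateOn : {A B : Set} → List (List A) → (ℕ → ℕ → B) → List (List B)
tabulateOn a f = map (λ i → map (f i) (upTo (rowLength a i))) (upTo (length a))

atOr : {A : Set} → A → List (List A) → ℕ → ℕ → A
atOr d a i j = fromMaybe d (at a i j)

nth-applyUpTo : {A B : Set} (xs : List A) (f : ℕ → B) (i : ℕ) →
  nth (applyUpTo f (length xs)) i ≡ Maybe.map (λ _ → f i) (nth xs i)
nth-applyUpTo []       f i       = refl
nth-applyUpTo (x ∷ xs) f zero    = refl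
nth-applyUpTo (x ∷ xs) f (suc i) = nth-applyUpTo xs (f ∘ suc) i

nth-map-upTo : {A B : Set} (xs : List A) (f : ℕ → B) (i : ℕ) →
  nth (map f (upTo (length xs))) i ≡ Maybe.map (λ _ → f i) (nth xs i)
nth-map-upTo xs f i rewrite map-upTo f (length xs) = nth-applyUpTo xs f i

nth-just : {A : Set} (xs : List A) (j : ℕ) → j < length xs → ∃ λ x → nth xs j ≡ just x
nth-just (x ∷ xs) zero    _        = x , refl
nth-just (x ∷ xs) (suc j) (s≤s lt) = nth-just xs j lt

nth-nothing : {A : Set} (xs : List A) (j : ℕ) → length xs ≤ j → nth xs j ≡ nothing
nth-nothing []       j       _        = refl
nth-nothing (x ∷ xs) (suc j) (s≤s le) = nth-nothing xs j le

nth-just⇒< : {A : Set} (xs : List A) (j : ℕ) {x : A} → nth xs j ≡ just x → j < length xs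
nth-just⇒< (x ∷ xs) zero    _ = s≤s z≤n
nth-just⇒< (x ∷ xs) (suc j) e = s≤s (nth-just⇒< xs j e)

nth-ext : {A : Set} (xs ys : List A) → (∀ j → nth xs j ≡ nth ys j) → xs ≡ ys
nth-ext []       []       _ = refl
nth-ext []       (y ∷ ys) e with e 0
... | ()
nth-ext (x ∷ xs) []       e with e 0
... | ()
nth-ext (x ∷ xs) (y ∷ ys) e with e 0
... | refl = cong (x ∷_) (nth-ext xs ys (e ∘ suc))

map-just⇒ : {A B : Set} {f : A → B} (mx my : Maybe A) {a : A} →
  mx ≡ just a → Maybe.map f mx ≡ Maybe.map f my → ∃ λ b → my ≡ just b × f a ≡ f b
map-just⇒ (just a) (just b) refl q = b , refl , just-injective q

at-row : {A : Set} (a : List (List A)) (i j : ℕ) → at a i j ≡ nth (fromMaybe [] (nth a i)) j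
at-row a i j with nth a i
... | nothing = refl
... | just _  = refl

InShape⇒at : {A : Set} (a : List (List A)) {i j : ℕ} → InShape a i j → ∃ λ x → at a i j ≡ just x
InShape⇒at a {i} {j} (inShape lt) rewrite at-row a i j = nth-just (fromMaybe [] (nth a i)) j lt

at⇒InShape : {A : Set} (a : List (List A)) {i j : ℕ} {x : A} → at a i j ≡ just x → InShape a i j
at⇒InShape a {i} {j} e rewrite at-row a i j = inShape (nth-just⇒< (fromMaybe [] (nth a i)) j e)

¬InShape⇒at : {A : Set} (a : List (List A)) {i j : ℕ} → ¬ InShape a i j → at a i j ≡ nothing
¬InShape⇒at a {i} {j} ni rewrite at-row a i j = nth-nothing (fromMaybe [] (nth a i)) j (≮⇒≥ (ni ∘ inShape))

InShape? : {A : Set} (a : List (List A)) (i j : ℕ) → Dec (InShape a i j)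
InShape? a i j = map′ inShape column< (j <? rowLength a i)

InShape-left : {A : Set} (a : List (List A)) {i j j′ : ℕ} → j ≤ j′ → InShape a i j′ → InShape a i j
InShape-left a le (inShape lt) = inShape (≤-<-trans le lt)

at≡atOr : {A : Set} (d : A) (a : List (List A)) {i j : ℕ} → InShape a i j → at a i j ≡ just (atOr d a i j)
at≡atOr d a lt with InShape⇒at a lt
... | x , e rewrite e = refl

at⇒atOr : {A : Set} (d : A) (a : List (List A)) {i j : ℕ} {x : A} → at a i j ≡ just x → atOr d a i j ≡ x
at⇒atOr d a e rewrite e = refl

at-ext : {A : Set} (a b : List (List A)) → length a ≡ length b → (∀ i j → at a i j ≡ at b i j) → a ≡ b
at-ext []      []      _  _ = refl
at-ext (x ∷ a) (y ∷ b) le e =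
  cong₂ _∷_ (nth-ext x y (e 0)) (at-ext a b (suc-injective le) (λ i → e (suc i)))

module _ {A B : Set} (a : List (List A)) (f : ℕ → ℕ → B) where

  at-tabulateOn : ∀ i j → at (tabulateOn a f) i j ≡ Maybe.map (λ _ → f i j) (at a i j)
  at-tabulateOn i j with nth a i in eq
  ... | nothing rewrite nth-map-upTo a (λ i → map (f i) (upTo (rowLength a i))) i | eq = refl
  ... | just r  rewrite nth-map-upTo a (λ i → map (f i) (upTo (rowLength a i))) i | eq
    = nth-map-upTo r (f i) j

  length-tabulateOn : length (tabulateOn a f) ≡ length a
  length-tabulateOn rewrite map-upTo (λ i → map (f i) (upTo (rowLength a i))) (length a) =
    length-applyUpTo _ (length a)

  rowLength-tabulateOn : ∀ i → rowLength (tabulateOn a f) i ≡ rowLength a i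
  rowLength-tabulateOn i rewrite nth-map-upTo a (λ i → map (f i) (upTo (rowLength a i))) i
    with nth a i
  ... | nothing = refl
  ... | just r  = trans (length-map (f i) (upTo (length r))) (length-upTo (length r))

  InShape-tabulateOn : ∀ {i j} → InShape a i j → InShape (tabulateOn a f) i j
  InShape-tabulateOn {i} (inShape lt) = inShape (subst (_ <_) (sym (rowLength-tabulateOn i)) lt)

  InShape-tabulateOn⁻ : ∀ {i j} → InShape (tabulateOn a f) i j → InShape a i j
  InShape-tabulateOn⁻ {i} (inShape lt) = inShape (subst (_ <_) (rowLength-tabulateOn i) lt)

  at-tabulateOn-InShape : ∀ {i j} → InShape a i j → at (tabulateOn a f) i j ≡ just (f i j)
  at-tabulateOn-InShape {i} {j} lt rewrite at-tabulateOn i j with InShape⇒at a lt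
  ... | x , e rewrite e = refl

  atOr-tabulateOn : (d : B) → ∀ {i j} → InShape a i j → atOr d (tabulateOn a f) i j ≡ f i j
  atOr-tabulateOn d lt rewrite at-tabulateOn-InShape lt = refl

  at-tabulateOn⇒ : ∀ {i j x} → at (tabulateOn a f) i j ≡ just x → InShape a i j × f i j ≡ x
  at-tabulateOn⇒ {i} {j} e with at a i j in eq | trans (sym (at-tabulateOn i j)) e
  ... | just _ | refl = at⇒InShape a eq , refl

  tabulateOn-rowsNonempty : All (λ row → 0 < length row) a →
                            All (λ row → 0 < length row) (tabulateOn a f)
  tabulateOn-rowsNonempty ne = fromRowLength (tabulateOn a f) λ i lt →
    subst (0 <_) (sym (rowLength-tabulateOn i)) (toRowLength a ne i (subst (i <_) length-tabulateOn lt))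
    where
    toRowLength : {C : Set} (c : List (List C)) → All (λ row → 0 < length row) c →
                  ∀ i → i < length c → 0 < rowLength c i
    toRowLength (x ∷ c) (px ∷ _)   zero    _        = px
    toRowLength (x ∷ c) (_  ∷ pxs) (suc i) (s≤s lt) = toRowLength c pxs i lt
    fromRowLength : {C : Set} (c : List (List C)) → (∀ i → i < length c → 0 < rowLength c i) →
                    All (λ row → 0 < length row) c
    fromRowLength []      _ = []
    fromRowLength (x ∷ c) h = h 0 (s≤s z≤n) ∷ fromRowLength c (λ i lt → h (suc i) (s≤s lt))

tabulateOn-id : {A : Set} (d : A) (a : List (List A)) (f : ℕ → ℕ → A) →
  (∀ i j → InShape a i j → f i j ≡ atOr d a i j) → tabulateOn a f ≡ a
tabulateOn-id d a f h = at-ext (tabulateOn a f) a (length-tabulateOn a f) pointwise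
  where
  pointwise : ∀ i j → at (tabulateOn a f) i j ≡ at a i j
  pointwise i j rewrite at-tabulateOn a f i j with at a i j in eq
  ... | nothing = refl
  ... | just x  = cong just (trans (h i j (at⇒InShape a eq)) (at⇒atOr d a eq))

tabulateOn-tabulateOn : {A B C : Set} (a : List (List A)) (f : ℕ → ℕ → B) (h : ℕ → ℕ → C) →
  tabulateOn (tabulateOn a f) h ≡ tabulateOn a h
tabulateOn-tabulateOn a f h =
  at-ext _ _ (trans (length-tabulateOn (tabulateOn a f) h) (trans (length-tabulateOn a f) (sym (length-tabulateOn a h))))
    pointwise
  where
  pointwise : ∀ i j → at (tabulateOn (tabulateOn a f) h) i j ≡ at (tabulateOn a h) i j
  pointwise i j rewrite at-tabulateOn (tabulateOn a f) h i j | at-tabulateOn a f i j | at-tabulateOn a h i j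
    with at a i j
  ... | nothing = refl
  ... | just _  = refl

bool-ext : ∀ {a b : Bool} → (a ≡ true → b ≡ true) → (b ≡ true → a ≡ true) → a ≡ b
bool-ext {false} {false} _ _ = refl
bool-ext {false} {true}  _ g = g refl
bool-ext {true}  {false} f _ = sym (f refl)
bool-ext {true}  {true}  _ _ = refl

∧-true₁ : ∀ {a b} → a ∧ b ≡ true → a ≡ true
∧-true₁ {true} _ = refl

∧-true₂ : ∀ {a b} → a ∧ b ≡ true → b ≡ true
∧-true₂ {true} e = e

∧-cong-when-true : ∀ {a b c} → (a ≡ true → b ≡ c) → a ∧ b ≡ a ∧ c
∧-cong-when-true {false} _ = refl
∧-cong-when-true {true}  f = f refl

≡ᵇ-true⇒≡ : ∀ {a b} → (a ≡ᵇ b) ≡ true → a ≡ b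
≡ᵇ-true⇒≡ {a} {b} e = ≡ᵇ⇒≡ a b (subst T (sym e) tt)

≡⇒≡ᵇ-true : ∀ {a b} → a ≡ b → (a ≡ᵇ b) ≡ true
≡⇒≡ᵇ-true {a} {b} e with a ≡ᵇ b in eq
... | true  = refl
... | false = ⊥-elim (subst T eq (≡⇒≡ᵇ a b e))

≢⇒≡ᵇ-false : ∀ {a b} → a ≢ b → (a ≡ᵇ b) ≡ false
≢⇒≡ᵇ-false {a} {b} ne with a ≡ᵇ b in eq
... | true  = ⊥-elim (ne (≡ᵇ-true⇒≡ eq))
... | false = refl

≡ᵇ-false⇒≢ : ∀ {a b} → (a ≡ᵇ b) ≡ false → a ≢ b
≡ᵇ-false⇒≢ {a} e refl = Bool.not-¬ e (≡⇒≡ᵇ-true {a} refl)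

<ᵇ-true⇒< : ∀ {a b} → (a <ᵇ b) ≡ true → a < b
<ᵇ-true⇒< {a} {b} e = <ᵇ⇒< a b (subst T (sym e) tt)

<⇒<ᵇ-true : ∀ {a b} → a < b → (a <ᵇ b) ≡ true
<⇒<ᵇ-true {a} {b} lt with a <ᵇ b in eq
... | true  = refl
... | false = ⊥-elim (subst T eq (<⇒<ᵇ lt))

<ᵇ-false⇒≥ : ∀ {a b} → (a <ᵇ b) ≡ false → b ≤ a
<ᵇ-false⇒≥ e = ≮⇒≥ (λ lt → Bool.not-¬ e (<⇒<ᵇ-true lt))

colHas⇒at : (c : PP) (j v : ℕ) → colHas c j v ≡ true → ∃ λ i → at c i j ≡ just v
colHas⇒at (row ∷ c) j v e with nth row j in eq
... | nothing with colHas⇒at c j v e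
...   | i , e′ = suc i , e′
colHas⇒at (row ∷ c) j v e | just x with x ≡ᵇ v in eq′
... | true  = 0 , trans eq (cong just (≡ᵇ-true⇒≡ eq′))
... | false with colHas⇒at c j v e
...   | i , e′ = suc i , e′

at⇒colHas : (c : PP) (i j v : ℕ) → at c i j ≡ just v → colHas c j v ≡ true
at⇒colHas (row ∷ c) zero    j v e rewrite e | ≡⇒≡ᵇ-true {v} refl = refl
at⇒colHas (row ∷ c) (suc i) j v e rewrite at⇒colHas c i j v e = Bool.∨-zeroʳ _

module _ (P : ℕ → Bool) where

  countBelow-suc-true : ∀ N → P N ≡ true → countBelow P (suc N) ≡ suc (countBelow P N)
  countBelow-suc-true N e rewrite e = +-comm (countBelow P N) 1

  countBelow-mono : ∀ {a b} → a ≤ b → countBelow P a ≤ countBelow P b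
  countBelow-mono le = mono′ (≤⇒≤′ le)
    where
    mono′ : ∀ {a b} → a ≤′ b → countBelow P a ≤ countBelow P b
    mono′ ≤′-refl       = ≤-refl
    mono′ (≤′-step le′) = ≤-trans (mono′ le′) (m≤m+n _ _)

  countBelow-<⇒∃ : ∀ a b → countBelow P a < countBelow P b → ∃ λ k → a ≤ k × k < b × P k ≡ true
  countBelow-<⇒∃ a zero    lt = ⊥-elim (<⇒≱ lt z≤n)
  countBelow-<⇒∃ a (suc b) lt with a ≤? b
  ... | no a≰b = ⊥-elim (<⇒≱ lt (countBelow-mono (≰⇒> a≰b)))
  ... | yes a≤b with P b in eq
  ...   | true  = b , a≤b , ≤-refl , eq
  ...   | false with countBelow-<⇒∃ a b (subst (countBelow P a <_) (+-identityʳ (countBelow P b)) lt)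
  ...     | k , a≤k , k<b , Pk = k , a≤k , m≤n⇒m≤1+n k<b , Pk

  countBelow-rank≥ : ∀ t N → countBelow (λ k → P k ∧ not (countBelow P k <ᵇ t)) N ≡ countBelow P N ∸ t
  countBelow-rank≥ t zero = sym (0∸n≡0 t)
  countBelow-rank≥ t (suc N) with P N
  ... | false rewrite +-identityʳ (countBelow (λ k → P k ∧ not (countBelow P k <ᵇ t)) N)
                    | +-identityʳ (countBelow P N) = countBelow-rank≥ t N
  ... | true with countBelow P N <ᵇ t in lt
  ...   | true  = begin
      countBelow (λ k → P k ∧ not (countBelow P k <ᵇ t)) N + 0 ≡⟨ +-identityʳ _ ⟩
      countBelow (λ k → P k ∧ not (countBelow P k <ᵇ t)) N     ≡⟨ countBelow-rank≥ t N ⟩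
      countBelow P N ∸ t                                       ≡⟨ m≤n⇒m∸n≡0 (<⇒≤ N<t) ⟩
      0                                                        ≡⟨ m≤n⇒m∸n≡0 (subst (_≤ t) (+-comm 1 (countBelow P N)) N<t) ⟨
      countBelow P N + 1 ∸ t                                   ∎
    where
    open ≡-Reasoning
    N<t = <ᵇ-true⇒< {countBelow P N} {t} lt
  ...   | false rewrite countBelow-rank≥ t N = sym (+-∸-comm 1 (<ᵇ-false⇒≥ {countBelow P N} {t} lt))

countBelow-cong : (P Q : ℕ → Bool) (N : ℕ) → (∀ k → k < N → P k ≡ Q k) → countBelow P N ≡ countBelow Q N
countBelow-cong P Q zero    _ = refl
countBelow-cong P Q (suc N) h rewrite h N ≤-refl =
  cong (_+ (if Q N then 1 else 0)) (countBelow-cong P Q N (λ k lt → h k (m≤n⇒m≤1+n lt)))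

-- Entries 2t + 2 and 2t + 1

-- The two entries that Ω turns into tiles labelled t + 1.
hi lo : ℕ → ℕ
hi t = suc (suc (t + t))
lo t = suc (t + t)

⌈n+n/2⌉≡n : ∀ n → ⌈ n + n /2⌉ ≡ n
⌈n+n/2⌉≡n n = sym (n≡⌈n+n/2⌉ n)

⌊n+n/2⌋≡n : ∀ n → ⌊ n + n /2⌋ ≡ n
⌊n+n/2⌋≡n n = sym (n≡⌊n+n/2⌋ n)

n+n%2≡0 : ∀ n → (n + n) % 2 ≡ 0
n+n%2≡0 zero    = refl
n+n%2≡0 (suc n) rewrite +-suc n n = n+n%2≡0 n

⌈hi/2⌉ : ∀ t → ⌈ hi t /2⌉ ≡ suc t
⌈hi/2⌉ t = cong suc (⌈n+n/2⌉≡n t)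

⌈lo/2⌉ : ∀ t → ⌈ lo t /2⌉ ≡ suc t
⌈lo/2⌉ t = cong suc (⌊n+n/2⌋≡n t)

hi%2 : ∀ t → hi t % 2 ≡ 0
hi%2 = n+n%2≡0

lo%2 : ∀ t → lo t % 2 ≡ 1
lo%2 zero    = refl
lo%2 (suc t) rewrite +-suc t t = lo%2 t

partner-hi : ∀ t → partner (hi t) ≡ lo t
partner-hi t rewrite hi%2 t = refl

partner-lo : ∀ t → partner (lo t) ≡ hi t
partner-lo t rewrite lo%2 t = refl

even-or-odd : ∀ v → ∃ λ h → (v ≡ h + h) ⊎ (v ≡ suc (h + h))
even-or-odd zero = 0 , inj₁ refl
even-or-odd (suc v) with even-or-odd v
... | h , inj₁ e = h , inj₂ (cong suc e)
... | h , inj₂ e = suc h , inj₁ (cong suc (trans e (sym (+-suc h h))))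

data HiLo (v : ℕ) : Set where
  is-zero : v ≡ 0 → HiLo v
  is-hi   : ∀ t → v ≡ hi t → HiLo v
  is-lo   : ∀ t → v ≡ lo t → HiLo v

hiLo : ∀ v → HiLo v
hiLo v with even-or-odd v
... | zero  , inj₁ e = is-zero e
... | suc t , inj₁ e = is-hi t (trans e (cong suc (+-suc t t)))
... | h     , inj₂ e = is-lo h e

hi≢lo : ∀ {t t′} → hi t ≢ lo t′
hi≢lo {t} {t′} e with trans (sym (lo%2 t′)) (trans (cong (_% 2) (sym e)) (hi%2 t))
... | ()

hi-injective : ∀ {t t′} → hi t ≡ hi t′ → t ≡ t′
hi-injective {t} {t′} e = suc-injective (trans (sym (⌈hi/2⌉ t)) (trans (cong ⌈_/2⌉ e) (⌈hi/2⌉ t′)))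

lo-injective : ∀ {t t′} → lo t ≡ lo t′ → t ≡ t′
lo-injective {t} {t′} e = suc-injective (trans (sym (⌈lo/2⌉ t)) (trans (cong ⌈_/2⌉ e) (⌈lo/2⌉ t′)))

⌈/2⌉≡suc⇒hi⊎lo : ∀ {v t} → ⌈ v /2⌉ ≡ suc t → (v ≡ hi t) ⊎ (v ≡ lo t)
⌈/2⌉≡suc⇒hi⊎lo {v} {t} e with hiLo v
... | is-zero refl = ⊥-elim (0≢1+n e)
... | is-hi t′ refl rewrite suc-injective (trans (sym (⌈hi/2⌉ t′)) e) = inj₁ refl
... | is-lo t′ refl rewrite suc-injective (trans (sym (⌈lo/2⌉ t′)) e) = inj₂ refl

hi⊎lo⇒⌈/2⌉ : ∀ {t v} → (v ≡ hi t) ⊎ (v ≡ lo t) → ⌈ v /2⌉ ≡ suc t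
hi⊎lo⇒⌈/2⌉ {t} (inj₁ refl) = ⌈hi/2⌉ t
hi⊎lo⇒⌈/2⌉ {t} (inj₂ refl) = ⌈lo/2⌉ t

hi⊎lo⇒lo≤∧≤hi : ∀ {t v} → (v ≡ hi t) ⊎ (v ≡ lo t) → lo t ≤ v × v ≤ hi t
hi⊎lo⇒lo≤∧≤hi (inj₁ refl) = n≤1+n _ , ≤-refl
hi⊎lo⇒lo≤∧≤hi (inj₂ refl) = ≤-refl , n≤1+n _

lo≤∧≤hi⇒hi⊎lo : ∀ {t v} → lo t ≤ v → v ≤ hi t → (v ≡ hi t) ⊎ (v ≡ lo t)
lo≤∧≤hi⇒hi⊎lo {t} {v} lo≤v v≤hi with v ≟ lo t
... | yes e = inj₂ e
... | no ne = inj₁ (≤-antisym v≤hi (≤∧≢⇒< lo≤v (ne ∘ sym)))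

n+n<m+m⇒n<m : ∀ {a b} → a + a < b + b → a < b
n+n<m+m⇒n<m {a} {b} lt with ≤-<-connex b a
... | inj₁ b≤a = ⊥-elim (<⇒≱ lt (+-mono-≤ b≤a b≤a))
... | inj₂ a<b = a<b

n+n≤m+m⇒n≤m : ∀ {a b} → a + a ≤ b + b → a ≤ b
n+n≤m+m⇒n≤m {a} {b} le with ≤-<-connex a b
... | inj₁ a≤b = a≤b
... | inj₂ b<a = ⊥-elim (<⇒≱ (+-mono-< b<a b<a) le)

n+n<m+m⇒1+n+n<m+m : ∀ {a b} → a + a < b + b → suc (a + a) < b + b
n+n<m+m⇒1+n+n<m+m {a} {b} lt with n+n<m+m⇒n<m {a} {b} lt
... | a<b = subst (_≤ b + b) (cong suc (+-suc a a)) (+-mono-≤ a<b a<b)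

hi<lo : ∀ {u t} → u < t → hi u < lo t
hi<lo {u} {t} lt = s≤s (subst (_≤ t + t) (cong suc (+-suc u u)) (+-mono-≤ lt lt))

hi-mono : ∀ {u t} → u ≤ t → hi u ≤ hi t
hi-mono le = s≤s (s≤s (+-mono-≤ le le))

<⇒⌈/2⌉<⊎hi-lo : ∀ {x y} → y < x → ⌈ y /2⌉ < ⌈ x /2⌉ ⊎ (∃ λ t → x ≡ hi t × y ≡ lo t)
<⇒⌈/2⌉<⊎hi-lo {x} {y} lt with hiLo x | hiLo y
... | is-zero refl | _            = ⊥-elim (<⇒≱ lt z≤n)
... | is-hi t refl | is-zero refl = inj₁ (subst (0 <_) (sym (⌈hi/2⌉ t)) (s≤s z≤n))
... | is-lo t refl | is-zero refl = inj₁ (subst (0 <_) (sym (⌈lo/2⌉ t)) (s≤s z≤n))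
... | is-hi t refl | is-hi t′ refl rewrite ⌈hi/2⌉ t | ⌈hi/2⌉ t′ =
  inj₁ (s≤s (n+n<m+m⇒n<m (≤-pred (≤-pred lt))))
... | is-lo t refl | is-hi t′ refl rewrite ⌈lo/2⌉ t | ⌈hi/2⌉ t′ =
  inj₁ (s≤s (n+n<m+m⇒n<m (≤-trans (n≤1+n _) (≤-pred lt))))
... | is-lo t refl | is-lo t′ refl rewrite ⌈lo/2⌉ t | ⌈lo/2⌉ t′ =
  inj₁ (s≤s (n+n<m+m⇒n<m (≤-pred lt)))
... | is-hi t refl | is-lo t′ refl with t′ ≟ t
...   | yes refl = inj₂ (t , refl , refl)
...   | no ne rewrite ⌈hi/2⌉ t | ⌈lo/2⌉ t′ = inj₁ (s≤s (≤∧≢⇒< (n+n≤m+m⇒n≤m (≤-pred (≤-pred lt))) ne))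

%2≡ᵇ0⇒even : ∀ p → (p % 2 ≡ᵇ 0) ≡ true → ∃ λ h → p ≡ h + h
%2≡ᵇ0⇒even p e with even-or-odd p
... | h , inj₁ e′ = h , e′
... | h , inj₂ e′ rewrite e′ | lo%2 h = ⊥-elim (Bool.not-¬ refl e)

%2≢ᵇ0⇒odd : ∀ p → (p % 2 ≡ᵇ 0) ≡ false → ∃ λ h → p ≡ suc (h + h)
%2≢ᵇ0⇒odd p e with even-or-odd p
... | h , inj₂ e′ = h , e′
... | h , inj₁ e′ rewrite e′ | n+n%2≡0 h = ⊥-elim (Bool.not-¬ e refl)

n+n-even : ∀ h → ((h + h) % 2 ≡ᵇ 0) ≡ true
n+n-even h rewrite n+n%2≡0 h = refl

1+n+n-odd : ∀ h → (suc (h + h) % 2 ≡ᵇ 0) ≡ false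
1+n+n-odd h rewrite lo%2 h = refl

even-positive⇒hi : ∀ v → 0 < v → (v % 2 ≡ᵇ 0) ≡ true → ∃ λ t → v ≡ hi t
even-positive⇒hi v pos e with hiLo v
... | is-zero refl = ⊥-elim (<-irrefl refl pos)
... | is-hi t e′   = t , e′
... | is-lo t e′ rewrite e′ | lo%2 t = ⊥-elim (Bool.not-¬ refl e)

odd⇒lo : ∀ v → (v % 2 ≡ᵇ 0) ≡ false → ∃ λ t → v ≡ lo t
odd⇒lo v e with hiLo v
... | is-zero refl = ⊥-elim (Bool.not-¬ e refl)
... | is-hi t e′ rewrite e′ | hi%2 t = ⊥-elim (Bool.not-¬ e refl)
... | is-lo t e′   = t , e′

partner-⌈/2⌉ : ∀ {t v} → (v ≡ hi t) ⊎ (v ≡ lo t) → ⌈ partner v /2⌉ ≡ suc t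
partner-⌈/2⌉ {t} (inj₁ refl) = trans (cong ⌈_/2⌉ (partner-hi t)) (⌈lo/2⌉ t)
partner-⌈/2⌉ {t} (inj₂ refl) = trans (cong ⌈_/2⌉ (partner-lo t)) (⌈hi/2⌉ t)

partner-≢ : ∀ {t v} → (v ≡ hi t) ⊎ (v ≡ lo t) → v ≢ partner v
partner-≢ {t} (inj₁ refl) q = hi≢lo {t} {t} (trans q (partner-hi t))
partner-≢ {t} (inj₂ refl) q = hi≢lo {t} {t} (sym (trans q (partner-lo t)))

%2≡1⇒lo : ∀ {v} → v % 2 ≡ 1 → ∃ λ t → v ≡ lo t
%2≡1⇒lo {v} odd with hiLo v
... | is-zero refl = ⊥-elim (0≢1+n odd)
... | is-hi t refl = ⊥-elim (0≢1+n (trans (sym (hi%2 t)) odd))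
... | is-lo t e    = t , e

if-hi-lo-≡ᵇhi : ∀ b t → ((if b then hi t else lo t) ≡ᵇ hi t) ≡ b
if-hi-lo-≡ᵇhi true  t = ≡⇒≡ᵇ-true {hi t} refl
if-hi-lo-≡ᵇhi false t = ≢⇒≡ᵇ-false (hi≢lo {t} {t} ∘ sym)

if-hi-lo-≡ᵇlo : ∀ b t → ((if b then hi t else lo t) ≡ᵇ lo t) ≡ not b
if-hi-lo-≡ᵇlo true  t = ≢⇒≡ᵇ-false (hi≢lo {t} {t})
if-hi-lo-≡ᵇlo false t = ≡⇒≡ᵇ-true {lo t} refl

hi⊎lo⇒≡if : ∀ {v t b} → (v ≡ hi t) ⊎ (v ≡ lo t) → (v ≡ᵇ hi t) ≡ b → v ≡ (if b then hi t else lo t)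
hi⊎lo⇒≡if {b = true}  _          q = ≡ᵇ-true⇒≡ q
hi⊎lo⇒≡if {b = false} (inj₁ e) q = ⊥-elim (Bool.not-¬ q (≡⇒≡ᵇ-true e))
hi⊎lo⇒≡if {b = false} (inj₂ e) _ = e

hi⊎lo-even : ∀ {v t} → (v ≡ hi t) ⊎ (v ≡ lo t) → (v % 2 ≡ᵇ 0) ≡ true → v ≡ hi t
hi⊎lo-even     (inj₁ e) _    = e
hi⊎lo-even {t = t} (inj₂ e) even = ⊥-elim (Bool.not-¬ (trans (cong (λ v → v % 2 ≡ᵇ 0) e) (cong (_≡ᵇ 0) (lo%2 t))) even)

hi⊎lo-odd : ∀ {v t} → (v ≡ hi t) ⊎ (v ≡ lo t) → (v % 2 ≡ᵇ 0) ≡ false → v ≡ lo t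
hi⊎lo-odd     (inj₂ e) _   = e
hi⊎lo-odd {t = t} (inj₁ e) odd = ⊥-elim (Bool.not-¬ odd (trans (cong (λ v → v % 2 ≡ᵇ 0) e) (cong (_≡ᵇ 0) (hi%2 t))))

%2≡ᵇ1⇒%2≢ᵇ0 : ∀ v → (v % 2 ≡ᵇ 1) ≡ true → (v % 2 ≡ᵇ 0) ≡ false
%2≡ᵇ1⇒%2≢ᵇ0 v q rewrite ≡ᵇ-true⇒≡ {v % 2} {1} q = refl

-- Column-strict plane partitions

val-at : (c : PP) {i j : ℕ} → InShape c i j → at c i j ≡ just (val c i j)
val-at c = at≡atOr 0 c

colHas⇒val : (c : PP) (j v : ℕ) → colHas c j v ≡ true → ∃ λ i → InShape c i j × val c i j ≡ v
colHas⇒val c j v e with colHas⇒at c j v e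
... | i , e′ = i , at⇒InShape c e′ , at⇒atOr 0 c e′

val⇒colHas : (c : PP) {i j v : ℕ} → InShape c i j → val c i j ≡ v → colHas c j v ≡ true
val⇒colHas c {i} {j} {v} lt e = at⇒colHas c i j v (trans (val-at c lt) (cong just e))

module InC-Properties {n m : ℕ} {c : PP} (ic : InC n m c) where
  open InC ic

  val-positive : ∀ {i j} → InShape c i j → 0 < val c i j
  val-positive {i} {j} lt = positive i j _ (val-at c lt)

  column<n : ∀ {i j} → InShape c i j → suc j ≤ n
  column<n {i} {j} lt = columns i j _ (val-at c lt)

  suc-column≤n+m : ∀ {i j} → InShape c i j → suc j ≤ n + m
  suc-column≤n+m lt = ≤-trans (column<n lt) (m≤m+n n m)

  val-bound : ∀ {i j} → InShape c i j → val c i j ≤ n + m ∸ suc j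
  val-bound {i} {j} lt = bound i j _ (val-at c lt)

  val+suc-column≤n+m : ∀ {i j} → InShape c i j → val c i j + suc j ≤ n + m
  val+suc-column≤n+m {i} {j} lt =
    subst (val c i j + suc j ≤_) (m∸n+n≡m (suc-column≤n+m lt)) (+-monoˡ-≤ (suc j) (val-bound lt))

  val-row-antitone : ∀ {i j j′} → j ≤ j′ → InShape c i j′ → val c i j′ ≤ val c i j
  val-row-antitone le = go (≤⇒≤′ le)
    where
    go : ∀ {i j j′} → j ≤′ j′ → InShape c i j′ → val c i j′ ≤ val c i j
    go ≤′-refl       _  = ≤-refl
    go {i} {j} {suc j′} (≤′-step le) lt =
      let lt′ = InShape-left c (n≤1+n j′) lt in
      ≤-trans (rowWeak i j′ _ _ (val-at c lt′) (val-at c lt)) (go le lt′)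

  InShape-up : ∀ {i j} → InShape c (suc i) j → InShape c i j
  InShape-up {i} {j} lt = at⇒InShape c (proj₂ (shape i j _ (val-at c lt)))

  InShape-up* : ∀ {i i′ j} → i ≤ i′ → InShape c i′ j → InShape c i j
  InShape-up* le = go (≤⇒≤′ le)
    where
    go : ∀ {i i′ j} → i ≤′ i′ → InShape c i′ j → InShape c i j
    go ≤′-refl       lt = lt
    go (≤′-step le′) lt = go le′ (InShape-up lt)

  val-col-step : ∀ {i j} → InShape c (suc i) j → val c (suc i) j < val c i j
  val-col-step {i} {j} lt = colStrict i j _ _ (val-at c (InShape-up lt)) (val-at c lt)

  val-col-antitone : ∀ {i i′ j} → i ≤ i′ → InShape c i′ j → val c i′ j ≤ val c i j
  val-col-antitone le = go (≤⇒≤′ le)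
    where
    go : ∀ {i i′ j} → i ≤′ i′ → InShape c i′ j → val c i′ j ≤ val c i j
    go ≤′-refl       _  = ≤-refl
    go (≤′-step le′) lt = ≤-trans (<⇒≤ (val-col-step lt)) (go le′ (InShape-up lt))

  val-col-< : ∀ {i i′ j} → i < i′ → InShape c i′ j → val c i′ j < val c i j
  val-col-< lt lt′ = ≤-<-trans (val-col-antitone lt lt′) (val-col-step (InShape-up* lt lt′))

  lo-below-hi : ∀ {i j t} → InShape c i j → val c i j ≡ hi t → colHas c j (lo t) ≡ true →
                InShape c (suc i) j × val c (suc i) j ≡ lo t
  lo-below-hi {i} {j} {t} lt e h with colHas⇒val c j (lo t) h
  ... | i′ , lt′ , e′ with <-cmp i′ i
  ...   | tri< i′<i _ _ = ⊥-elim (<⇒≱ (val-col-< i′<i lt) (subst₂ _≤_ (sym e′) (sym e) (n≤1+n _)))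
  ...   | tri≈ _ refl _ = ⊥-elim (hi≢lo {t} {t} (trans (sym e) e′))
  ...   | tri> _ _ i<i′ = lt₁ , ≤-antisym (≤-pred (subst (val c (suc i) j <_) e (val-col-step lt₁)))
                                         (subst (_≤ val c (suc i) j) e′ (val-col-antitone i<i′ lt′))
    where lt₁ = InShape-up* i<i′ lt′

  hi-above-lo : ∀ {i j t} → InShape c i j → val c i j ≡ lo t → colHas c j (hi t) ≡ true →
                ∃ λ i₀ → i ≡ suc i₀ × InShape c i₀ j × val c i₀ j ≡ hi t
  hi-above-lo {i} {j} {t} lt e h with colHas⇒val c j (hi t) h
  ... | i′ , lt′ , e′ with <-cmp i′ i
  ...   | tri≈ _ refl _ = ⊥-elim (hi≢lo {t} {t} (trans (sym e′) e))
  ...   | tri> _ _ i<i′ = ⊥-elim (<⇒≱ (val-col-< i<i′ lt′) (subst₂ _≤_ (sym e) (sym e′) (n≤1+n _)))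
  hi-above-lo {suc i} {j} {t} lt e h | i′ , lt′ , e′ | tri< i′<i _ _ =
    i , refl , InShape-up lt ,
    ≤-antisym (subst (val c i j ≤_) e′ (val-col-antitone (≤-pred i′<i) (InShape-up lt)))
              (subst (_< val c i j) e (val-col-step lt))

-- Twisted Bender–Knuth involutions and the fixed points of ρ̃

βfreeLowerCount : ℕ → ℕ → ℕ → PP → ℕ → ℕ
βfreeLowerCount n m r c i = countBelow (λ k → βfree n m r c i k ∧ (val c i k ≡ᵇ (r ∸ 1))) (rowLength c i)

βcell : ℕ → ℕ → ℕ → PP → ℕ → ℕ → ℕ
βcell n m r c i j =
  if βfree n m r c i j
  then (if countBelow (βfree n m r c i) j <ᵇ βfreeLowerCount n m r c i then r else r ∸ 1)
  else val c i j

βcell-free : ∀ {n m r c i j} → βfree n m r c i j ≡ true →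
  βcell n m r c i j ≡ (if countBelow (βfree n m r c i) j <ᵇ βfreeLowerCount n m r c i then r else r ∸ 1)
βcell-free e rewrite e = refl

βcell-fixed : ∀ {n m r c i j} → βfree n m r c i j ≡ false → βcell n m r c i j ≡ val c i j
βcell-fixed e rewrite e = refl

markOf : ℕ → ℕ → Bool × Bool
markOf r v = (v ≡ᵇ r) , (v ≡ᵇ (r ∸ 1))

mark : ℕ → PP → ℕ → ℕ → Maybe (Bool × Bool)
mark r x i j = Maybe.map (markOf r) (at x i j)

record Agree (r : ℕ) (x y : PP) : Set where
  constructor agreeing
  field mark≡ : ∀ i j → mark r x i j ≡ mark r y i j
open Agree

freeOfMark : ℕ → ℕ → ℕ → Bool → Bool → ℕ → Maybe (Bool × Bool) → Bool
freeOfMark n m r hasR hasR-1 j nothing              = false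
freeOfMark n m r hasR hasR-1 j (just (isR , isR-1)) =
  (isR ∨ isR-1) ∧ not (hasR ∧ hasR-1) ∧ not (isR-1 ∧ ((suc j + (r ∸ 1)) ≡ᵇ (n + m)))

βfree-mark : ∀ n m r c i j →
  βfree n m r c i j ≡ freeOfMark n m r (colHas c j r) (colHas c j (r ∸ 1)) j (mark r c i j)
βfree-mark n m r c i j with at c i j
... | nothing = refl
... | just v with v ≡ᵇ (r ∸ 1) in e
...   | false = refl
...   | true rewrite ≡ᵇ-true⇒≡ {v} {r ∸ 1} e = refl

freeOfMark-just : ∀ {n m r h₁ h₂ j} mv → freeOfMark n m r h₁ h₂ j (Maybe.map (markOf r) mv) ≡ true →
  ∃ λ v → mv ≡ just v × ((v ≡ r) ⊎ (v ≡ r ∸ 1))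
freeOfMark-just {r = r} (just v) e with v ≡ᵇ r in isR | v ≡ᵇ (r ∸ 1) in isR-1
... | true  | _     = v , refl , inj₁ (≡ᵇ-true⇒≡ isR)
... | false | true  = v , refl , inj₂ (≡ᵇ-true⇒≡ isR-1)
... | false | false = ⊥-elim (Bool.not-¬ refl e)

βfree-just : ∀ {n m r c i j} → βfree n m r c i j ≡ true → ∃ λ v → at c i j ≡ just v × ((v ≡ r) ⊎ (v ≡ r ∸ 1))
βfree-just {n} {m} {r} {c} {i} {j} e = freeOfMark-just (at c i j) (trans (sym (βfree-mark n m r c i j)) e)

βfree-val : ∀ {n m r c i j} → βfree n m r c i j ≡ true → (val c i j ≡ r) ⊎ (val c i j ≡ r ∸ 1)
βfree-val {n} {m} {r} {c} {i} {j} e with βfree-just {n} {m} {r} {c} {i} {j} e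
... | v , e₁ , h rewrite e₁ = h

module _ {r : ℕ} where

  agree-sym : ∀ {x y} → Agree r x y → Agree r y x
  agree-sym s = agreeing λ i j → sym (mark≡ s i j)

  agree-trans : ∀ {x y z} → Agree r x y → Agree r y z → Agree r x z
  agree-trans s s′ = agreeing λ i j → trans (mark≡ s i j) (mark≡ s′ i j)

  agree-just : ∀ {x y i j v} → Agree r x y → at x i j ≡ just v →
               ∃ λ w → at y i j ≡ just w × markOf r v ≡ markOf r w
  agree-just {x} {y} {i} {j} s e = map-just⇒ (at x i j) (at y i j) e (mark≡ s i j)

  agree-InShape : ∀ {x y i j} → Agree r x y → InShape x i j → InShape y i j
  agree-InShape {x} {y} s lt with InShape⇒at x lt
  ... | _ , e with agree-just {x} {y} s e
  ...   | _ , e′ , _ = at⇒InShape y e′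

  agree-val : ∀ {x y i j} → Agree r x y → InShape x i j → markOf r (val x i j) ≡ markOf r (val y i j)
  agree-val {x} {y} s lt with agree-just {x} {y} s (val-at x lt)
  ... | w , e′ , q = trans q (cong (markOf r) (sym (at⇒atOr 0 y e′)))

  agree-at : ∀ {x y i j u} → Agree r x y → (u ≡ r) ⊎ (u ≡ r ∸ 1) → at x i j ≡ just u → at y i j ≡ just u
  agree-at {x} {y} {u = u} s h e with agree-just {x} {y} s e
  ... | w , e′ , q = trans e′ (cong just (≡ᵇ-true⇒≡ {w} {u} (same h)))
    where
    same : (u ≡ r) ⊎ (u ≡ r ∸ 1) → (w ≡ᵇ u) ≡ true
    same (inj₁ refl) = trans (sym (cong proj₁ q)) (≡⇒≡ᵇ-true {u} refl)
    same (inj₂ refl) = trans (sym (cong proj₂ q)) (≡⇒≡ᵇ-true {u} refl)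

  agree-colHas : ∀ {x y j u} → Agree r x y → (u ≡ r) ⊎ (u ≡ r ∸ 1) → colHas x j u ≡ colHas y j u
  agree-colHas {x} {y} {j} {u} s h = bool-ext
    (λ e → let i , e′ = colHas⇒at x j u e in at⇒colHas y i j u (agree-at {x} {y} s h e′))
    (λ e → let i , e′ = colHas⇒at y j u e in at⇒colHas x i j u (agree-at {y} {x} (agree-sym s) h e′))

  agree-βfree : ∀ {n m x y} i j → Agree r x y → βfree n m r x i j ≡ βfree n m r y i j
  agree-βfree {n} {m} {x} {y} i j s = begin
    βfree n m r x i j                                                         ≡⟨ βfree-mark n m r x i j ⟩
    freeOfMark n m r (colHas x j r) (colHas x j (r ∸ 1)) j (mark r x i j)     ≡⟨ cong₂ (λ h₁ h₂ → freeOfMark n m r h₁ h₂ j (mark r x i j))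
                                                                                    (agree-colHas s (inj₁ refl)) (agree-colHas s (inj₂ refl)) ⟩
    freeOfMark n m r (colHas y j r) (colHas y j (r ∸ 1)) j (mark r x i j)     ≡⟨ cong (freeOfMark n m r (colHas y j r) (colHas y j (r ∸ 1)) j) (mark≡ s i j) ⟩
    freeOfMark n m r (colHas y j r) (colHas y j (r ∸ 1)) j (mark r y i j)     ≡⟨ βfree-mark n m r y i j ⟨
    βfree n m r y i j                                                         ∎
    where open ≡-Reasoning

  agree-rowLength : ∀ {x y} i → Agree r x y → rowLength x i ≡ rowLength y i
  agree-rowLength {x} {y} i s =
    ≤-antisym (bound (λ j lt → column< (agree-InShape s (inShape lt))))
              (bound (λ j lt → column< (agree-InShape (agree-sym s) (inShape lt))))
    where
    bound : ∀ {a b} → (∀ j → j < a → j < b) → a ≤ b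
    bound {zero}  _ = z≤n
    bound {suc a} f = f a ≤-refl

  agree-βfreeLowerCount : ∀ {n m x y} i → Agree r x y → βfreeLowerCount n m r x i ≡ βfreeLowerCount n m r y i
  agree-βfreeLowerCount {n} {m} {x} {y} i s =
    trans (cong (countBelow _) (agree-rowLength i s)) (countBelow-cong _ _ (rowLength y i) λ k _ → lower k)
    where
    lower : ∀ k → (βfree n m r x i k ∧ (val x i k ≡ᵇ (r ∸ 1))) ≡ (βfree n m r y i k ∧ (val y i k ≡ᵇ (r ∸ 1)))
    lower k = trans (cong (_∧ _) (agree-βfree i k s)) (∧-cong-when-true λ free →
      sym (cong proj₂ (agree-val (agree-sym s) (at⇒InShape y (proj₁ (proj₂ (βfree-just {n} {m} {r} {y} {i} {k} free)))))))

mark-tabulateOn : ∀ {r} (x : PP) (f : ℕ → ℕ → ℕ) {i j} → InShape x i j →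
  mark r (tabulateOn x f) i j ≡ just (markOf r (f i j))
mark-tabulateOn {r} x f lt = cong (Maybe.map (markOf r)) (at-tabulateOn-InShape x f lt)

mark-tabulateOn-outside : ∀ {r} (x : PP) (f : ℕ → ℕ → ℕ) {i j} → ¬ InShape x i j →
  mark r (tabulateOn x f) i j ≡ nothing
mark-tabulateOn-outside {r} x f nl =
  cong (Maybe.map (markOf r)) (¬InShape⇒at (tabulateOn x f) (nl ∘ InShape-tabulateOn⁻ x f))

agree-tabulateOn : ∀ {r} (x y : PP) (f g : ℕ → ℕ → ℕ) → Agree r x y →
  (∀ {i j} → InShape x i j → markOf r (f i j) ≡ markOf r (g i j)) →
  Agree r (tabulateOn x f) (tabulateOn y g)
agree-tabulateOn {r} x y f g s h = agreeing pointwise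
  where
  pointwise : ∀ i j → mark r (tabulateOn x f) i j ≡ mark r (tabulateOn y g) i j
  pointwise i j with InShape? x i j
  ... | yes lt = trans (mark-tabulateOn x f lt)
                   (trans (cong just (h lt)) (sym (mark-tabulateOn y g (agree-InShape s lt))))
  ... | no nl  = trans (mark-tabulateOn-outside x f nl)
                   (sym (mark-tabulateOn-outside y g (nl ∘ agree-InShape (agree-sym s))))

agree-tabulateOn-self : ∀ {r} (x : PP) (f : ℕ → ℕ → ℕ) →
  (∀ {i j} → InShape x i j → markOf r (f i j) ≡ markOf r (val x i j)) → Agree r (tabulateOn x f) x
agree-tabulateOn-self {r} x f h = subst (Agree r (tabulateOn x f)) (tabulateOn-id 0 x (val x) λ _ _ _ → refl)
  (agree-tabulateOn x x f (val x) (agreeing λ _ _ → refl) h)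

β-agree : ∀ n m r {x y} → Agree r x y → Agree r (β n m r x) (β n m r y)
β-agree n m r {x} {y} s = agree-tabulateOn x y (βcell n m r x) (βcell n m r y) s cell
  where
  cell : ∀ {i j} → InShape x i j → markOf r (βcell n m r x i j) ≡ markOf r (βcell n m r y i j)
  cell {i} {j} lt = byFreedom (βfree n m r y i j) refl
    where
    byFreedom : ∀ b → βfree n m r y i j ≡ b → markOf r (βcell n m r x i j) ≡ markOf r (βcell n m r y i j)
    byFreedom true free = cong (markOf r) (begin
      βcell n m r x i j                                                                        ≡⟨ βcell-free {n} {m} {r} {x} {i} {j} (trans (agree-βfree i j s) free) ⟩
      (if countBelow (βfree n m r x i) j <ᵇ βfreeLowerCount n m r x i then r else r ∸ 1)     ≡⟨ cong₂ (λ a b → if a <ᵇ b then r else r ∸ 1)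
                                                                                                  (countBelow-cong _ _ j (λ k _ → agree-βfree i k s))
                                                                                                  (agree-βfreeLowerCount i s) ⟩
      (if countBelow (βfree n m r y i) j <ᵇ βfreeLowerCount n m r y i then r else r ∸ 1)     ≡⟨ βcell-free {n} {m} {r} {y} {i} {j} free ⟨
      βcell n m r y i j                                                                        ∎)
      where open ≡-Reasoning
    byFreedom false free =
      trans (cong (markOf r) (βcell-fixed {n} {m} {r} {x} {i} {j} (trans (agree-βfree i j s) free)))
            (trans (agree-val s lt) (cong (markOf r) (sym (βcell-fixed {n} {m} {r} {y} {i} {j} free))))

Disjoint : ℕ → ℕ → Set
Disjoint r′ r = ∀ u → (u ≡ r′) ⊎ (u ≡ r′ ∸ 1) → markOf r u ≡ (false , false)

β-agree-disjoint : ∀ n m r′ r x → Disjoint r′ r → Agree r (β n m r′ x) x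
β-agree-disjoint n m r′ r x d = agree-tabulateOn-self x (βcell n m r′ x) λ {i} {j} _ → cell i j (βfree n m r′ x i j) refl
  where
  cell : ∀ i j b → βfree n m r′ x i j ≡ b → markOf r (βcell n m r′ x i j) ≡ markOf r (val x i j)
  cell i j false free = cong (markOf r) (βcell-fixed {n} {m} {r′} {x} {i} {j} free)
  cell i j true  free = trans (cong (markOf r) (βcell-free {n} {m} {r′} {x} {i} {j} free))
                          (trans (moved (countBelow (βfree n m r′ x i) j <ᵇ βfreeLowerCount n m r′ x i))
                                 (sym (d _ (βfree-val {n} {m} {r′} {x} {i} {j} free))))
    where
    moved : ∀ b → markOf r (if b then r′ else r′ ∸ 1) ≡ (false , false)
    moved true  = d r′ (inj₁ refl)
    moved false = d (r′ ∸ 1) (inj₂ refl)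

composeβ : ℕ → ℕ → List ℕ → PP → PP
composeβ n m = foldr (λ r f → β n m r ∘ f) id

composeβ-agree-absent : ∀ n m r (f : ℕ → ℕ) K x → (∀ i → i < K → Disjoint (f i) r) →
  Agree r (composeβ n m (applyUpTo f K) x) x
composeβ-agree-absent n m r f zero    x d = agreeing λ _ _ → refl
composeβ-agree-absent n m r f (suc K) x d =
  agree-trans (β-agree-disjoint n m (f 0) r _ (d 0 (s≤s z≤n)))
              (composeβ-agree-absent n m r (f ∘ suc) K x (λ i lt → d (suc i) (s≤s lt)))

composeβ-agree-present : ∀ n m r (f : ℕ → ℕ) K x t → t < K → f t ≡ r →
  (∀ i → i < K → i ≢ t → Disjoint (f i) r) → Agree r (composeβ n m (applyUpTo f K) x) (β n m r x)
composeβ-agree-present n m r f (suc K) x zero _ refl d =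
  β-agree n m (f 0) (composeβ-agree-absent n m (f 0) (f ∘ suc) K x (λ i lt → d (suc i) (s≤s lt) λ ()))
composeβ-agree-present n m r f (suc K) x (suc t) (s≤s lt) e d =
  agree-trans (β-agree-disjoint n m (f 0) r _ (d 0 (s≤s z≤n) λ ()))
              (composeβ-agree-present n m r (f ∘ suc) K x t lt e (λ i lt′ ne → d (suc i) (s≤s lt′) (ne ∘ suc-injective)))

composeβ-fixed : ∀ n m (f : ℕ → ℕ) K x → (∀ i → β n m (f i) x ≡ x) → composeβ n m (applyUpTo f K) x ≡ x
composeβ-fixed n m f zero    x h = refl
composeβ-fixed n m f (suc K) x h rewrite composeβ-fixed n m (f ∘ suc) K x (h ∘ suc) = h 0

2*suc≡hi : ∀ t → 2 * suc t ≡ hi t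
2*suc≡hi t = cong suc (trans (cong (t +_) (+-identityʳ (suc t))) (+-suc t t))

2*suc-disjoint : ∀ i t → i ≢ t → Disjoint (2 * suc i) (hi t)
2*suc-disjoint i t ne u (inj₁ e) rewrite trans e (2*suc≡hi i) =
  cong₂ _,_ (≢⇒≡ᵇ-false (ne ∘ hi-injective)) (≢⇒≡ᵇ-false (hi≢lo {i} {t}))
2*suc-disjoint i t ne u (inj₂ e) rewrite trans e (cong (_∸ 1) (2*suc≡hi i)) =
  cong₂ _,_ (≢⇒≡ᵇ-false (hi≢lo {t} {i} ∘ sym)) (≢⇒≡ᵇ-false (ne ∘ lo-injective))

ρ̃≡composeβ : ∀ n m c → ρ̃ n m c ≡ composeβ n m (applyUpTo (λ i → 2 * suc i) ((n + m) / 2)) c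
ρ̃≡composeβ n m c = cong (λ L → composeβ n m L c) (map-upTo (λ i → 2 * suc i) ((n + m) / 2))

hi≤⇒<half : ∀ t k → hi t ≤ k → t < k / 2
hi≤⇒<half t k le = subst (_≤ k / 2) (m*n/n≡m (suc t) 2)
  (/-monoˡ-≤ 2 (subst (_≤ k) (trans (sym (2*suc≡hi t)) (*-comm 2 (suc t))) le))

-- In every row the free entries r come before the free entries r - 1; for r = hi t this is β_r c ≡ c.
FreeSorted : ℕ → ℕ → ℕ → PP → Set
FreeSorted n m r c = ∀ i j → βfree n m r c i j ≡ true →
  (val c i j ≡ᵇ r) ≡ (countBelow (βfree n m r c i) j <ᵇ βfreeLowerCount n m r c i)

β-agree-self⇒FreeSorted : ∀ n m t c → Agree (hi t) (β n m (hi t) c) c → FreeSorted n m (hi t) c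
β-agree-self⇒FreeSorted n m t c s i j free = begin
  (val c i j ≡ᵇ hi t)                                    ≡⟨ cong proj₁ (agree-val s (InShape-tabulateOn c _ lt)) ⟨
  (val (β n m (hi t) c) i j ≡ᵇ hi t)                     ≡⟨ cong (_≡ᵇ hi t) (atOr-tabulateOn c _ 0 lt) ⟩
  (βcell n m (hi t) c i j ≡ᵇ hi t)                       ≡⟨ cong (_≡ᵇ hi t) (βcell-free {n} {m} {hi t} {c} {i} {j} free) ⟩
  ((if b then hi t else lo t) ≡ᵇ hi t)                   ≡⟨ if-hi-lo-≡ᵇhi b t ⟩
  b                                                      ∎
  where
  open ≡-Reasoning
  b = countBelow (βfree n m (hi t) c i) j <ᵇ βfreeLowerCount n m (hi t) c i
  lt : InShape c i j
  lt = at⇒InShape c (proj₁ (proj₂ (βfree-just {n} {m} {hi t} {c} {i} {j} free)))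

ρ̃-fixed⇒FreeSorted : ∀ n m t c → ρ̃ n m c ≡ c → hi t ≤ n + m → FreeSorted n m (hi t) c
ρ̃-fixed⇒FreeSorted n m t c fixed le = β-agree-self⇒FreeSorted n m t c (agreeing λ i j →
  trans (sym (mark≡ present i j)) (cong (λ z → mark (hi t) z i j) (trans (sym (ρ̃≡composeβ n m c)) fixed)))
  where
  present : Agree (hi t) (composeβ n m (applyUpTo (λ i → 2 * suc i) ((n + m) / 2)) c) (β n m (hi t) c)
  present = composeβ-agree-present n m (hi t) _ _ c t (hi≤⇒<half t (n + m) le) (2*suc≡hi t)
              (λ i _ ne → 2*suc-disjoint i t ne)

FreeSorted⇒β-fixed : ∀ n m t x → FreeSorted n m (hi t) x → β n m (hi t) x ≡ x
FreeSorted⇒β-fixed n m t x sorted = tabulateOn-id 0 x (βcell n m (hi t) x) λ i j _ → cell i j (βfree n m (hi t) x i j) refl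
  where
  cell : ∀ i j b → βfree n m (hi t) x i j ≡ b → βcell n m (hi t) x i j ≡ val x i j
  cell i j false free = βcell-fixed {n} {m} {hi t} {x} {i} {j} free
  cell i j true  free = trans (βcell-free {n} {m} {hi t} {x} {i} {j} free)
                              (sym (hi⊎lo⇒≡if {t = t} (βfree-val {n} {m} {hi t} {x} {i} {j} free) (sorted i j free)))

FreeSorted⇒ρ̃-fixed : ∀ n m x → (∀ t → FreeSorted n m (hi t) x) → ρ̃ n m x ≡ x
FreeSorted⇒ρ̃-fixed n m x sorted = trans (ρ̃≡composeβ n m x) (composeβ-fixed n m _ ((n + m) / 2) x λ i →
  subst (λ r → β n m r x ≡ x) (sym (2*suc≡hi i)) (FreeSorted⇒β-fixed n m i x (sorted i)))

-- The free r - 1's are exactly the free entries of rank ≥ l, so there are l free r's as well.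
FreeSorted⇒free-count : ∀ n m t x i → FreeSorted n m (hi t) x →
  countBelow (βfree n m (hi t) x i) (rowLength x i) ≡ βfreeLowerCount n m (hi t) x i + βfreeLowerCount n m (hi t) x i
FreeSorted⇒free-count n m t x i sorted = l≡F∸l⇒F≡l+l (begin
  l                                                   ≡⟨ countBelow-cong _ _ (rowLength x i) (λ k _ → lower k) ⟩
  countBelow (λ k → P k ∧ not (countBelow P k <ᵇ l)) (rowLength x i) ≡⟨ countBelow-rank≥ P l (rowLength x i) ⟩
  countBelow P (rowLength x i) ∸ l                    ∎)
  where
  open ≡-Reasoning
  P = βfree n m (hi t) x i
  l = βfreeLowerCount n m (hi t) x i
  lower : ∀ k → (P k ∧ (val x i k ≡ᵇ lo t)) ≡ (P k ∧ not (countBelow P k <ᵇ l))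
  lower k = ∧-cong-when-true λ free →
    trans (cong (_≡ᵇ lo t) (hi⊎lo⇒≡if {t = t} (βfree-val {n} {m} {hi t} {x} {i} {k} free) (sorted i k free)))
          (if-hi-lo-≡ᵇlo _ t)
  l≡F∸l⇒F≡l+l : ∀ {l F} → l ≡ F ∸ l → F ≡ l + l
  l≡F∸l⇒F≡l+l {l} {F} e with ≤-<-connex F l
  ... | inj₁ F≤l rewrite m≤n⇒m∸n≡0 F≤l with e
  ...   | refl = ≤-antisym F≤l z≤n
  l≡F∸l⇒F≡l+l {l} {F} e | inj₂ l<F = trans (sym (m+[n∸m]≡n (<⇒≤ l<F))) (cong (l +_) (sym e))

-- The map Ω

ΩfreeLabelled : ℕ → ℕ → PP → ℕ → ℕ → ℕ → Bool
ΩfreeLabelled n m c i s k = ΩfreeAt n m c i k ∧ (⌈ val c i k /2⌉ ≡ᵇ s)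

βfree≡ΩfreeLabelled : ∀ n m t c i k → βfree n m (hi t) c i k ≡ ΩfreeLabelled n m c i (suc t) k
βfree≡ΩfreeLabelled n m t c i k =
  trans (βfree-mark n m (hi t) c i k) (byEntry (at c i k) refl)
  where
  βfreeOf : Maybe ℕ → Bool
  βfreeOf mv = freeOfMark n m (hi t) (colHas c k (hi t)) (colHas c k (lo t)) k (Maybe.map (markOf (hi t)) mv)
  Ωfree : ℕ → Bool
  Ωfree v = (not (colHas c k (partner v)) ∧ not ((v % 2 ≡ᵇ 1) ∧ ((suc k + v) ≡ᵇ (n + m)))) ∧ (⌈ v /2⌉ ≡ᵇ suc t)
  unrelated : ∀ {a b x w l : Bool} → a ≡ false → b ≡ false → l ≡ false → ((a ∨ b) ∧ x) ≡ (w ∧ l)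
  unrelated {w = w} refl refl refl = sym (Bool.∧-zeroʳ w)
  top : ∀ {a b h₁ h₂ z p q z′ l : Bool} → a ≡ true → b ≡ false → h₁ ≡ true → p ≡ h₂ → q ≡ false → l ≡ true →
        ((a ∨ b) ∧ not (h₁ ∧ h₂) ∧ not (b ∧ z)) ≡ ((not p ∧ not (q ∧ z′)) ∧ l)
  top refl refl refl refl refl refl = sym (Bool.∧-identityʳ _)
  bottom : ∀ {a b h₁ h₂ z p q l : Bool} → a ≡ false → b ≡ true → h₂ ≡ true → p ≡ h₁ → q ≡ true → l ≡ true →
           ((a ∨ b) ∧ not (h₁ ∧ h₂) ∧ not (b ∧ z)) ≡ ((not p ∧ not (q ∧ z)) ∧ l)
  bottom {h₁ = h₁} refl refl refl refl refl refl rewrite Bool.∧-identityʳ h₁ = sym (Bool.∧-identityʳ _)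
  byValue : ∀ v → at c i k ≡ just v → βfreeOf (just v) ≡ Ωfree v
  byValue v e with hiLo v
  ... | is-zero refl = sym (Bool.∧-zeroʳ _)
  ... | is-hi t′ refl with t′ ≟ t
  ...   | no ne = unrelated (≢⇒≡ᵇ-false (ne ∘ hi-injective)) (≢⇒≡ᵇ-false (hi≢lo {t′} {t}))
                    (≢⇒≡ᵇ-false (ne ∘ suc-injective ∘ trans (sym (⌈hi/2⌉ t′))))
  ...   | yes refl = top (≡⇒≡ᵇ-true {hi t} refl) (≢⇒≡ᵇ-false (hi≢lo {t} {t}))
                      (at⇒colHas c i k (hi t) e) (cong (colHas c k) (partner-hi t))
                      (cong (_≡ᵇ 1) (hi%2 t)) (≡⇒≡ᵇ-true (⌈hi/2⌉ t))
  byValue v e | is-lo t′ refl with t′ ≟ t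
  ...   | no ne = unrelated (≢⇒≡ᵇ-false (hi≢lo {t} {t′} ∘ sym)) (≢⇒≡ᵇ-false (ne ∘ lo-injective))
                    (≢⇒≡ᵇ-false (ne ∘ suc-injective ∘ trans (sym (⌈lo/2⌉ t′))))
  ...   | yes refl = bottom (≢⇒≡ᵇ-false (hi≢lo {t} {t} ∘ sym)) (≡⇒≡ᵇ-true {lo t} refl)
                      (at⇒colHas c i k (lo t) e) (cong (colHas c k) (partner-lo t))
                      (cong (_≡ᵇ 1) (lo%2 t)) (≡⇒≡ᵇ-true (⌈lo/2⌉ t))
  byEntry : ∀ mv → at c i k ≡ mv → βfreeOf (at c i k) ≡ Ωfree (fromMaybe 0 (at c i k))
  byEntry nothing  e = trans (cong βfreeOf e) (sym (trans (cong (Ωfree ∘ fromMaybe 0) e) (Bool.∧-zeroʳ _)))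
  byEntry (just v) e = trans (cong βfreeOf e) (trans (byValue v e) (cong (Ωfree ∘ fromMaybe 0) (sym e)))

ΩhorizontalRank : ℕ → ℕ → PP → ℕ → ℕ → ℕ
ΩhorizontalRank n m c i j = countBelow (ΩfreeLabelled n m c i ⌈ val c i j /2⌉) j

Ωselect : Bool → Bool → Bool → Bool → ℕ → Tile × ℕ
Ωselect paired even saturated evenRank r =
  if paired then (if even then (vT , r) else (vB , r))
  else (if saturated then (sq , r) else (if evenRank then (hL , r) else (hR , r)))

Ωcell : ℕ → ℕ → PP → ℕ → ℕ → Tile × ℕ
Ωcell n m c i j = Ωselect (ΩpairedAt c i j) (val c i j % 2 ≡ᵇ 0) (ΩsatAt n m c i j)
                          (ΩhorizontalRank n m c i j % 2 ≡ᵇ 0) ⌈ val c i j /2⌉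

Ωcell-from : ∀ {n m c i j pa ev sa pe r} → ΩpairedAt c i j ≡ pa → (val c i j % 2 ≡ᵇ 0) ≡ ev →
  ΩsatAt n m c i j ≡ sa → (ΩhorizontalRank n m c i j % 2 ≡ᵇ 0) ≡ pe → ⌈ val c i j /2⌉ ≡ r →
  Ωcell n m c i j ≡ Ωselect pa ev sa pe r
Ωcell-from refl refl refl refl refl = refl

TileSpec : Tile → Bool → Bool → Bool → Bool → Set
TileSpec vT paired even saturated evenRank = paired ≡ true × even ≡ true
TileSpec vB paired even saturated evenRank = paired ≡ true × even ≡ false
TileSpec sq paired even saturated evenRank = paired ≡ false × saturated ≡ true
TileSpec hL paired even saturated evenRank = paired ≡ false × saturated ≡ false × evenRank ≡ true
TileSpec hR paired even saturated evenRank = paired ≡ false × saturated ≡ false × evenRank ≡ false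

Ωselect-spec : ∀ pa ev sa pe r T a → Ωselect pa ev sa pe r ≡ (T , a) → r ≡ a × TileSpec T pa ev sa pe
Ωselect-spec true  true  sa    pe    r .vT .r refl = refl , refl , refl
Ωselect-spec true  false sa    pe    r .vB .r refl = refl , refl , refl
Ωselect-spec false ev    true  pe    r .sq .r refl = refl , refl , refl
Ωselect-spec false ev    false true  r .hL .r refl = refl , refl , refl , refl
Ωselect-spec false ev    false false r .hR .r refl = refl , refl , refl , refl

Ω-InShape : ∀ n m c {i j} → InShape c i j → at (Ω n m c) i j ≡ just (Ωcell n m c i j)
Ω-InShape n m c = at-tabulateOn-InShape c (Ωcell n m c)

Ω-spec : ∀ n m c {i j T a} → at (Ω n m c) i j ≡ just (T , a) →
  InShape c i j × ⌈ val c i j /2⌉ ≡ a ×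
  TileSpec T (ΩpairedAt c i j) (val c i j % 2 ≡ᵇ 0) (ΩsatAt n m c i j) (ΩhorizontalRank n m c i j % 2 ≡ᵇ 0)
Ω-spec n m c {i} {j} {T} {a} e with at-tabulateOn⇒ c (Ωcell n m c) e
... | lt , q with Ωselect-spec _ _ _ _ _ T a q
...   | r≡a , spec = lt , r≡a , spec

ΩfreeLabelled⇒ : ∀ {n m c i s k} → ΩfreeLabelled n m c i s k ≡ true →
  ΩpairedAt c i k ≡ false × ΩsatAt n m c i k ≡ false × ⌈ val c i k /2⌉ ≡ s
ΩfreeLabelled⇒ {n} {m} {c} {i} {s} {k} e with ΩpairedAt c i k | ΩsatAt n m c i k | ⌈ val c i k /2⌉ ≡ᵇ s in eq
ΩfreeLabelled⇒ refl | false | false | true = refl , refl , ≡ᵇ-true⇒≡ eq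

ΩfreeLabelled-intro : ∀ {n m c i s k} → ΩpairedAt c i k ≡ false → ΩsatAt n m c i k ≡ false →
  ⌈ val c i k /2⌉ ≡ s → ΩfreeLabelled n m c i s k ≡ true
ΩfreeLabelled-intro e₁ e₂ e₃ rewrite e₁ | e₂ | ≡⇒≡ᵇ-true e₃ = refl

⌈val/2⌉≡suc⇒InShape : ∀ c {i k t} → ⌈ val c i k /2⌉ ≡ suc t → InShape c i k
⌈val/2⌉≡suc⇒InShape c {i} {k} e with InShape? c i k
... | yes lt = lt
... | no nl rewrite ¬InShape⇒at c nl = ⊥-elim (0≢1+n e)

ΩfreeLabelled-paired : ∀ {n m c i s k} → ΩpairedAt c i k ≡ true → ΩfreeLabelled n m c i s k ≡ false
ΩfreeLabelled-paired {n} {m} {c} {i} {s} {k} e =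
  cong (λ p → (not p ∧ not (ΩsatAt n m c i k)) ∧ (⌈ val c i k /2⌉ ≡ᵇ s)) e

ΩfreeLabelled-saturated : ∀ {n m c i s k} → ΩsatAt n m c i k ≡ true → ΩfreeLabelled n m c i s k ≡ false
ΩfreeLabelled-saturated {n} {m} {c} {i} {s} {k} e =
  trans (cong (λ q → (not (ΩpairedAt c i k) ∧ not q) ∧ (⌈ val c i k /2⌉ ≡ᵇ s)) e)
        (cong (_∧ (⌈ val c i k /2⌉ ≡ᵇ s)) (Bool.∧-zeroʳ (not (ΩpairedAt c i k))))

ΩfreeLabelled-other : ∀ {n m c i s k} → ⌈ val c i k /2⌉ ≢ s → ΩfreeLabelled n m c i s k ≡ false
ΩfreeLabelled-other {n} {m} {c} {i} {s} {k} ne =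
  trans (cong (ΩfreeAt n m c i k ∧_) (≢⇒≡ᵇ-false ne)) (Bool.∧-zeroʳ (ΩfreeAt n m c i k))

ΩhorizontalRank-label : ∀ {n m c i j s} → ⌈ val c i j /2⌉ ≡ s →
  ΩhorizontalRank n m c i j ≡ countBelow (ΩfreeLabelled n m c i s) j
ΩhorizontalRank-label {n} {m} {c} {i} {j} = cong (λ s → countBelow (ΩfreeLabelled n m c i s) j)

ΩpairedAt-hi : ∀ c i k {t} → val c i k ≡ hi t → ΩpairedAt c i k ≡ colHas c k (lo t)
ΩpairedAt-hi c i k {t} e = cong (colHas c k) (trans (cong partner e) (partner-hi t))

ΩpairedAt-lo : ∀ c i k {t} → val c i k ≡ lo t → ΩpairedAt c i k ≡ colHas c k (hi t)
ΩpairedAt-lo c i k {t} e = cong (colHas c k) (trans (cong partner e) (partner-lo t))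

ΩsatAt-hi : ∀ n m c i k {t} → val c i k ≡ hi t → ΩsatAt n m c i k ≡ false
ΩsatAt-hi n m c i k {t} e =
  trans (cong (λ v → (v % 2 ≡ᵇ 1) ∧ ((suc k + v) ≡ᵇ (n + m))) e) (cong (λ r → (r ≡ᵇ 1) ∧ ((suc k + hi t) ≡ᵇ (n + m))) (hi%2 t))

ΩsatAt-lo : ∀ n m c i k {t} → val c i k ≡ lo t → ΩsatAt n m c i k ≡ ((suc k + lo t) ≡ᵇ (n + m))
ΩsatAt-lo n m c i k {t} e =
  trans (cong (λ v → (v % 2 ≡ᵇ 1) ∧ ((suc k + v) ≡ᵇ (n + m))) e) (cong (λ r → (r ≡ᵇ 1) ∧ ((suc k + lo t) ≡ᵇ (n + m))) (lo%2 t))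

module FreeRuns {n m : ℕ} {c : PP} (ic : InC n m c) where
  open InC-Properties ic

  paired-hi-leftward : ∀ {i a x t} → a ≤ x → InShape c i x → val c i x ≡ hi t → val c i a ≡ hi t →
                       ΩpairedAt c i x ≡ true → ΩpairedAt c i a ≡ true
  paired-hi-leftward {i} {a} {x} {t} a≤x inx vx va px = trans (ΩpairedAt-hi c i a {t} va) (val⇒colHas c in₁ v₁)
    where
    below = lo-below-hi {t = t} inx vx (trans (sym (ΩpairedAt-hi c i x {t} vx)) px)
    in₁ = InShape-left c a≤x (proj₁ below)
    v₁ : val c (suc i) a ≡ lo t
    v₁ = ≤-antisym (≤-pred (subst (val c (suc i) a <_) va (val-col-step in₁)))
                   (subst (_≤ val c (suc i) a) (proj₂ below) (val-row-antitone a≤x (proj₁ below)))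

  paired-lo-rightward : ∀ {i x b t} → x ≤ b → InShape c i b → val c i x ≡ lo t → val c i b ≡ lo t →
                        ΩpairedAt c i x ≡ true → ΩpairedAt c i b ≡ true
  paired-lo-rightward {i} {x} {b} {t} x≤b inb vx vb px
    with hi-above-lo {t = t} (InShape-left c x≤b inb) vx (trans (sym (ΩpairedAt-lo c i x {t} vx)) px)
  ... | i₀ , refl , _ , v₀x = trans (ΩpairedAt-lo c (suc i₀) b {t} vb) (val⇒colHas c in₀ v₀)
    where
    in₀ = InShape-up inb
    v₀ : val c i₀ b ≡ hi t
    v₀ = ≤-antisym (subst (val c i₀ b ≤_) v₀x (val-row-antitone x≤b in₀))
                   (subst (_< val c i₀ b) vb (val-col-step inb))

  saturated-only-last : ∀ {i x b t} → x < b → InShape c i b → lo t ≤ val c i b → val c i x ≡ lo t →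
                        ΩsatAt n m c i x ≡ false
  saturated-only-last {i} {x} {b} {t} x<b inb le vx =
    trans (ΩsatAt-lo n m c i x {t} vx) (≢⇒≡ᵇ-false (<⇒≢ (begin-strict
      suc x + lo t   ≡⟨ +-comm (suc x) (lo t) ⟩
      lo t + suc x   <⟨ +-monoʳ-< (lo t) (s≤s x<b) ⟩
      lo t + suc b   ≤⟨ +-monoˡ-≤ (suc b) le ⟩
      val c i b + suc b ≤⟨ val+suc-column≤n+m inb ⟩
      n + m          ∎)))
    where open ≤-Reasoning

  -- Every entry between a and b is hi t or lo t. It is not paired, since a pair hi t over lo t propagates
  -- leftwards to a and a pair lo t under hi t rightwards to b, and a lo t is saturated only in column b.
  ΩfreeLabelled-convex : ∀ {i t a b x} → ΩfreeLabelled n m c i (suc t) a ≡ true →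
    ΩfreeLabelled n m c i (suc t) b ≡ true → a ≤ x → x ≤ b → ΩfreeLabelled n m c i (suc t) x ≡ true
  ΩfreeLabelled-convex {i} {t} {a} {b} {x} fa fb a≤x x≤b =
    ΩfreeLabelled-intro {n} {m} {c} {i} {suc t} {x} (Bool.¬-not notPaired) notSaturated (hi⊎lo⇒⌈/2⌉ vx)
    where
    A = ΩfreeLabelled⇒ {n} {m} {c} {i} {suc t} {a} fa
    B = ΩfreeLabelled⇒ {n} {m} {c} {i} {suc t} {b} fb
    inb = ⌈val/2⌉≡suc⇒InShape c (proj₂ (proj₂ B))
    inx = InShape-left c x≤b inb
    va = ⌈/2⌉≡suc⇒hi⊎lo (proj₂ (proj₂ A))
    vb = ⌈/2⌉≡suc⇒hi⊎lo (proj₂ (proj₂ B))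
    vx : (val c i x ≡ hi t) ⊎ (val c i x ≡ lo t)
    vx = lo≤∧≤hi⇒hi⊎lo {t} (≤-trans (proj₁ (hi⊎lo⇒lo≤∧≤hi {t} vb)) (val-row-antitone x≤b inb))
                       (≤-trans (val-row-antitone a≤x inx) (proj₂ (hi⊎lo⇒lo≤∧≤hi {t} va)))
    notSaturated : ΩsatAt n m c i x ≡ false
    notSaturated with vx | x ≟ b
    ... | inj₁ e | _        = ΩsatAt-hi n m c i x {t} e
    ... | inj₂ e | yes refl = proj₁ (proj₂ B)
    ... | inj₂ e | no x≢b   = saturated-only-last {t = t} (≤∧≢⇒< x≤b x≢b) inb (proj₁ (hi⊎lo⇒lo≤∧≤hi {t} vb)) e
    notPaired : ΩpairedAt c i x ≢ true
    notPaired px with vx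
    ... | inj₁ e = Bool.not-¬ (proj₁ A) (paired-hi-leftward {t = t} a≤x inx e vaHi px)
      where
      vaHi : val c i a ≡ hi t
      vaHi with va
      ... | inj₁ h = h
      ... | inj₂ h = ⊥-elim (<-irrefl refl (subst₂ _≤_ e h (val-row-antitone a≤x inx)))
    ... | inj₂ e = Bool.not-¬ (proj₁ B) (paired-lo-rightward {t = t} x≤b inb e vbLo px)
      where
      vbLo : val c i b ≡ lo t
      vbLo with vb
      ... | inj₂ h = h
      ... | inj₁ h = ⊥-elim (<-irrefl refl (subst₂ _≤_ h e (val-row-antitone x≤b inb)))

sq-of-spec : ∀ {T pa ev sa pe} → pa ≡ false → sa ≡ true → TileSpec T pa ev sa pe → T ≡ sq
sq-of-spec {vT} p _ (p′ , _)     = ⊥-elim (Bool.not-¬ p p′)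
sq-of-spec {vB} p _ (p′ , _)     = ⊥-elim (Bool.not-¬ p p′)
sq-of-spec {sq} _ _ _            = refl
sq-of-spec {hL} _ s (_ , s′ , _) = ⊥-elim (Bool.not-¬ s′ s)
sq-of-spec {hR} _ s (_ , s′ , _) = ⊥-elim (Bool.not-¬ s′ s)

module Ω-Valid {n m : ℕ} {c : PP} (ic : InC n m c) (fixed : ρ̃ n m c ≡ c) where
  open InC-Properties ic
  open FreeRuns ic

  label-positive : ∀ {i j} → InShape c i j → ∃ λ t → ⌈ val c i j /2⌉ ≡ suc t
  label-positive {i} {j} lt with hiLo (val c i j)
  ... | is-zero e = ⊥-elim (<-irrefl (sym e) (val-positive lt))
  ... | is-hi t e = t , trans (cong ⌈_/2⌉ e) (⌈hi/2⌉ t)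
  ... | is-lo t e = t , trans (cong ⌈_/2⌉ e) (⌈lo/2⌉ t)

  hi≤n+m : ∀ {i j t} → InShape c i j → ⌈ val c i j /2⌉ ≡ suc t → hi t ≤ n + m
  hi≤n+m {i} {j} {t} lt e = ≤-trans (s≤s (proj₁ (hi⊎lo⇒lo≤∧≤hi {t} (⌈/2⌉≡suc⇒hi⊎lo e))))
                                    (≤-trans (m<m+n (val c i j) z<s) (val+suc-column≤n+m lt))

  module _ (i t : ℕ) where

    private
      P : ℕ → Bool
      P = ΩfreeLabelled n m c i (suc t)

    free-count : hi t ≤ n + m →
      countBelow P (rowLength c i) ≡ βfreeLowerCount n m (hi t) c i + βfreeLowerCount n m (hi t) c i
    free-count le = trans (sym (countBelow-cong _ _ (rowLength c i) (λ k _ → βfree≡ΩfreeLabelled n m t c i k)))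
                          (FreeSorted⇒free-count n m t c i (ρ̃-fixed⇒FreeSorted n m t c fixed le))

    -- The free entries of a label form an interval of even length, so they pair off from the left.
    free-successor : ∀ {j h} → P j ≡ true → countBelow P j ≡ h + h →
                     P (suc j) ≡ true × countBelow P (suc j) ≡ suc (h + h)
    free-successor {j} {h} Pj even = ΩfreeLabelled-convex Pj (proj₂ (proj₂ (proj₂ later))) (n≤1+n j) (proj₁ (proj₂ later)) , count
      where
      label = proj₂ (proj₂ (ΩfreeLabelled⇒ {n} {m} {c} {i} {suc t} {j} Pj))
      l = βfreeLowerCount n m (hi t) c i
      total = free-count (hi≤n+m (⌈val/2⌉≡suc⇒InShape c label) label)
      count : countBelow P (suc j) ≡ suc (h + h)
      count = trans (countBelow-suc-true P j Pj) (cong suc even)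
      h+h<l+l : h + h < l + l
      h+h<l+l = subst₂ _≤_ count total (countBelow-mono P (column< (⌈val/2⌉≡suc⇒InShape c label)))
      later = countBelow-<⇒∃ P (suc j) (rowLength c i)
                (subst₂ _<_ (sym count) (sym total) (n+n<m+m⇒1+n+n<m+m {h} {l} h+h<l+l))

    free-predecessor : ∀ {j h} → P (suc j) ≡ true → countBelow P (suc j) ≡ suc (h + h) →
                       P j ≡ true × countBelow P j ≡ h + h
    free-predecessor {j} {h} Psj odd = Pj , suc-injective (trans (sym (countBelow-suc-true P j Pj)) odd)
      where
      earlier = countBelow-<⇒∃ P 0 (suc j) (subst (0 <_) (sym odd) z<s)
      Pj = ΩfreeLabelled-convex (proj₂ (proj₂ (proj₂ earlier))) Psj (≤-pred (proj₁ (proj₂ (proj₂ earlier)))) (n≤1+n j)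

    Ω-at-free : ∀ {k pe} → P k ≡ true → (countBelow P k % 2 ≡ᵇ 0) ≡ pe →
                at (Ω n m c) i k ≡ just (Ωselect false (val c i k % 2 ≡ᵇ 0) false pe (suc t))
    Ω-at-free {k} Pk parity = trans (Ω-InShape n m c (⌈val/2⌉≡suc⇒InShape c label))
      (cong just (Ωcell-from {n} {m} {c} {i} {k} paired refl saturated
                   (trans (cong (λ p → p % 2 ≡ᵇ 0) (ΩhorizontalRank-label {n} {m} {c} {i} {k} label)) parity) label))
      where
      paired = proj₁ (ΩfreeLabelled⇒ {n} {m} {c} {i} {suc t} {k} Pk)
      saturated = proj₁ (proj₂ (ΩfreeLabelled⇒ {n} {m} {c} {i} {suc t} {k} Pk))
      label = proj₂ (proj₂ (ΩfreeLabelled⇒ {n} {m} {c} {i} {suc t} {k} Pk))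

  horizontal-spec : ∀ {i j T a} → at (Ω n m c) i j ≡ just (T , a) →
    ΩpairedAt c i j ≡ false → ΩsatAt n m c i j ≡ false →
    ∃ λ t → a ≡ suc t × ΩfreeLabelled n m c i (suc t) j ≡ true ×
            ΩhorizontalRank n m c i j ≡ countBelow (ΩfreeLabelled n m c i (suc t)) j
  horizontal-spec {i} {j} e p s with Ω-spec n m c e
  ... | lt , la , _ with label-positive lt
  ...   | t , la′ = t , trans (sym la) la′ , ΩfreeLabelled-intro {n} {m} {c} {i} {suc t} {j} p s la′ ,
                    ΩhorizontalRank-label {n} {m} {c} {i} {j} la′

  hLright : ∀ i j a → at (Ω n m c) i j ≡ just (hL , a) → at (Ω n m c) i (suc j) ≡ just (hR , a)
  hLright i j a e with Ω-spec n m c e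
  ... | _ , _ , p , s , even with horizontal-spec e p s
  ...   | t , refl , Pj , rank = next (%2≡ᵇ0⇒even _ (trans (cong (λ r → r % 2 ≡ᵇ 0) (sym rank)) even))
    where
    next : (∃ λ h → countBelow (ΩfreeLabelled n m c i (suc t)) j ≡ h + h) → at (Ω n m c) i (suc j) ≡ just (hR , suc t)
    next (h , count) = Ω-at-free i t {pe = false} (proj₁ successor)
                         (trans (cong (λ r → r % 2 ≡ᵇ 0) (proj₂ successor)) (1+n+n-odd h))
      where successor = free-successor i t {h = h} Pj count

  hRleft : ∀ i j a → at (Ω n m c) i (suc j) ≡ just (hR , a) → at (Ω n m c) i j ≡ just (hL , a)
  hRleft i j a e with Ω-spec n m c e
  ... | _ , _ , p , s , odd with horizontal-spec e p s
  ...   | t , refl , Psj , rank = previous (%2≢ᵇ0⇒odd _ (trans (cong (λ r → r % 2 ≡ᵇ 0) (sym rank)) odd))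
    where
    previous : (∃ λ h → countBelow (ΩfreeLabelled n m c i (suc t)) (suc j) ≡ suc (h + h)) → at (Ω n m c) i j ≡ just (hL , suc t)
    previous (h , count) = Ω-at-free i t {pe = true} (proj₁ predecessor)
                             (trans (cong (λ r → r % 2 ≡ᵇ 0) (proj₂ predecessor)) (n+n-even h))
      where predecessor = free-predecessor i t {h = h} Psj count

  hRnot0 : ∀ i a → at (Ω n m c) i 0 ≢ just (hR , a)
  hRnot0 i a e with Ω-spec n m c e
  ... | _ , _ , _ , _ , odd = Bool.not-¬ odd refl

  Ω-at-hi-paired : ∀ {i j t} → InShape c i j → val c i j ≡ hi t → ΩpairedAt c i j ≡ true →
                   at (Ω n m c) i j ≡ just (vT , suc t)
  Ω-at-hi-paired {i} {j} {t} lt e p = trans (Ω-InShape n m c lt) (cong just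
    (Ωcell-from {n} {m} {c} {i} {j} p (trans (cong (λ v → v % 2 ≡ᵇ 0) e) (cong (_≡ᵇ 0) (hi%2 t))) refl refl
                (trans (cong ⌈_/2⌉ e) (⌈hi/2⌉ t))))

  Ω-at-lo-paired : ∀ {i j t} → InShape c i j → val c i j ≡ lo t → ΩpairedAt c i j ≡ true →
                   at (Ω n m c) i j ≡ just (vB , suc t)
  Ω-at-lo-paired {i} {j} {t} lt e p = trans (Ω-InShape n m c lt) (cong just
    (Ωcell-from {n} {m} {c} {i} {j} p (trans (cong (λ v → v % 2 ≡ᵇ 0) e) (cong (_≡ᵇ 0) (lo%2 t))) refl refl
                (trans (cong ⌈_/2⌉ e) (⌈lo/2⌉ t))))

  vTbelow : ∀ i j a → at (Ω n m c) i j ≡ just (vT , a) → at (Ω n m c) (suc i) j ≡ just (vB , a)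
  vTbelow i j a e with Ω-spec n m c e
  ... | lt , la , p , even with even-positive⇒hi (val c i j) (val-positive lt) even
  ...   | t , v≡hi rewrite trans (sym la) (trans (cong ⌈_/2⌉ v≡hi) (⌈hi/2⌉ t)) =
    Ω-at-lo-paired {t = t} (proj₁ below) (proj₂ below) (trans (ΩpairedAt-lo c (suc i) j {t} (proj₂ below)) (val⇒colHas c lt v≡hi))
    where below = lo-below-hi {t = t} lt v≡hi (trans (sym (ΩpairedAt-hi c i j {t} v≡hi)) p)

  vBabove : ∀ i j a → at (Ω n m c) (suc i) j ≡ just (vB , a) → at (Ω n m c) i j ≡ just (vT , a)
  vBabove i j a e with Ω-spec n m c e
  ... | lt , la , p , odd with odd⇒lo (val c (suc i) j) odd
  ...   | t , v≡lo with hi-above-lo {t = t} lt v≡lo (trans (sym (ΩpairedAt-lo c (suc i) j {t} v≡lo)) p)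
  ...     | .i , refl , in₀ , v₀ rewrite trans (sym la) (trans (cong ⌈_/2⌉ v≡lo) (⌈lo/2⌉ t)) =
    Ω-at-hi-paired {t = t} in₀ v₀ (trans (ΩpairedAt-hi c i j {t} v₀) (val⇒colHas c lt v≡lo))

  vBnot0 : ∀ j a → at (Ω n m c) 0 j ≢ just (vB , a)
  vBnot0 j a e with Ω-spec n m c e
  ... | lt , _ , p , odd with odd⇒lo (val c 0 j) odd
  ...   | t , v≡lo with hi-above-lo {t = t} lt v≡lo (trans (sym (ΩpairedAt-lo c 0 j {t} v≡lo)) p)
  ...     | _ , () , _

  positive : ∀ i j T x → at (Ω n m c) i j ≡ just (T , x) → 0 < x
  positive i j T x e with Ω-spec n m c e
  ... | lt , la , _ = subst (0 <_) la (⌈n/2⌉-mono {1} {val c i j} (val-positive lt))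

  rowWeak : ∀ i j T U x y → at (Ω n m c) i j ≡ just (T , x) → at (Ω n m c) i (suc j) ≡ just (U , y) → y ≤ x
  rowWeak i j T U x y e₁ e₂ with Ω-spec n m c e₁ | Ω-spec n m c e₂
  ... | _ , la₁ , _ | lt₂ , la₂ , _ = subst₂ _≤_ la₂ la₁ (⌈n/2⌉-mono (val-row-antitone (n≤1+n j) lt₂))

  colStrict : ∀ i j T U x y → at (Ω n m c) i j ≡ just (T , x) → at (Ω n m c) (suc i) j ≡ just (U , y) →
              T ≢ vT → y < x
  colStrict i j T U x y e₁ e₂ T≢vT with Ω-spec n m c e₁ | Ω-spec n m c e₂
  ... | lt₁ , la₁ , _ | lt₂ , la₂ , _ with <⇒⌈/2⌉<⊎hi-lo (val-col-step lt₂)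
  ...   | inj₁ lt = subst₂ _<_ la₂ la₁ lt
  ...   | inj₂ (t , v≡hi , v₁≡lo) = ⊥-elim (T≢vT (cong proj₁ (just-injective (trans (sym e₁)
           (Ω-at-hi-paired {t = t} lt₁ v≡hi (trans (ΩpairedAt-hi c i j {t} v≡hi) (val⇒colHas c lt₂ v₁≡lo)))))))

  E1 : ∀ i j p → at (Ω n m c) i j ≡ just p → suc j ≤ n
  E1 i j p e = column<n (proj₁ (at-tabulateOn⇒ c (Ωcell n m c) e))

  E2 : ∀ i j T x → at (Ω n m c) i j ≡ just (T , x) → x ≤ ⌈ (n + m ∸ suc j) /2⌉
  E2 i j T x e with Ω-spec n m c e
  ... | lt , la , _ = subst (_≤ ⌈ (n + m ∸ suc j) /2⌉) la (⌈n/2⌉-mono (val-bound lt))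

  -- When the column bound n + m - (j + 1) is odd, say lo t, the label t + 1 is reached only by the entry lo t itself,
  -- which cannot be paired since hi t exceeds the bound.
  last-label-saturated : ∀ {i j t} → InShape c i j → n + m ∸ suc j ≡ lo t → ⌈ val c i j /2⌉ ≡ suc t →
                         ΩpairedAt c i j ≡ false × ΩsatAt n m c i j ≡ true
  last-label-saturated {i} {j} {t} lt b≡lo la = Bool.¬-not notPaired , saturated
    where
    v≡lo : val c i j ≡ lo t
    v≡lo with ⌈/2⌉≡suc⇒hi⊎lo la
    ... | inj₂ h = h
    ... | inj₁ h = ⊥-elim (<-irrefl refl (subst₂ _≤_ h b≡lo (val-bound lt)))
    notPaired : ΩpairedAt c i j ≢ true
    notPaired p with colHas⇒val c j (hi t) (trans (sym (ΩpairedAt-lo c i j {t} v≡lo)) p)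
    ... | _ , lt′ , v′ = <-irrefl refl (subst₂ _≤_ v′ b≡lo (val-bound lt′))
    saturated : ΩsatAt n m c i j ≡ true
    saturated = trans (ΩsatAt-lo n m c i j {t} v≡lo)
      (≡⇒≡ᵇ-true (trans (cong (suc j +_) (sym b≡lo)) (m+[n∸m]≡n (suc-column≤n+m lt))))

  E3a : ∀ i j T x → at (Ω n m c) i j ≡ just (T , x) → (n + m ∸ suc j) % 2 ≡ 1 →
        x ≡ ⌈ (n + m ∸ suc j) /2⌉ → T ≡ sq
  E3a i j T x e odd x≡ with Ω-spec n m c e | %2≡1⇒lo odd
  ... | lt , la , spec | t , b≡lo with last-label-saturated lt b≡lo (trans la (trans x≡ (trans (cong ⌈_/2⌉ b≡lo) (⌈lo/2⌉ t))))
  ...   | notPaired , saturated = sq-of-spec notPaired saturated spec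

  E3b : ∀ i j x → at (Ω n m c) i j ≡ just (sq , x) →
        ((n + m ∸ suc j) % 2 ≡ 1) × (x ≡ ⌈ (n + m ∸ suc j) /2⌉)
  E3b i j x e with Ω-spec n m c e
  ... | lt , la , _ , sat = trans (cong (_% 2) b≡v) (≡ᵇ-true⇒≡ (∧-true₁ sat)) , trans (sym la) (cong ⌈_/2⌉ (sym b≡v))
    where
    b≡v : n + m ∸ suc j ≡ val c i j
    b≡v = trans (cong (_∸ suc j) (sym (≡ᵇ-true⇒≡ {suc j + val c i j} {n + m} (∧-true₂ {val c i j % 2 ≡ᵇ 1} sat))))
                (m+n∸m≡n (suc j) (val c i j))

  Ω-InG : InG n m (Ω n m c)
  Ω-InG = record
    { rowsNonempty = tabulateOn-rowsNonempty c (Ωcell n m c) (InC.rowsNonempty ic)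
    ; shape = λ i j x e → _ , Ω-InShape n m c (InShape-up (proj₁ (at-tabulateOn⇒ c (Ωcell n m c) e)))
    ; hLright = hLright ; hRleft = hRleft ; hRnot0 = hRnot0
    ; vTbelow = vTbelow ; vBabove = vBabove ; vBnot0 = vBnot0
    ; positive = positive ; rowWeak = rowWeak ; colStrict = colStrict
    ; E1 = E1 ; E2 = E2 ; E3a = E3a ; E3b = E3b }

-- The inverse map Ψ

horizontalLabelled : Maybe (Tile × ℕ) → ℕ → Bool
horizontalLabelled (just (hL , a)) s = a ≡ᵇ s
horizontalLabelled (just (hR , a)) s = a ≡ᵇ s
horizontalLabelled _               s = false

horizontalLabelled-Ωselect : ∀ pa ev sa pe r s →
  horizontalLabelled (just (Ωselect pa ev sa pe r)) s ≡ ((not pa ∧ not sa) ∧ (r ≡ᵇ s))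
horizontalLabelled-Ωselect true  true  sa    pe    r s = refl
horizontalLabelled-Ωselect true  false sa    pe    r s = refl
horizontalLabelled-Ωselect false ev    true  pe    r s = refl
horizontalLabelled-Ωselect false ev    false true  r s = refl
horizontalLabelled-Ωselect false ev    false false r s = refl

ΩfreeLabelled≡horizontalLabelled : ∀ n m c i t k →
  ΩfreeLabelled n m c i (suc t) k ≡ horizontalLabelled (at (Ω n m c) i k) (suc t)
ΩfreeLabelled≡horizontalLabelled n m c i t k with InShape? c i k
... | yes lt rewrite Ω-InShape n m c lt =
  sym (horizontalLabelled-Ωselect (ΩpairedAt c i k) (val c i k % 2 ≡ᵇ 0) (ΩsatAt n m c i k)
                                  (ΩhorizontalRank n m c i k % 2 ≡ᵇ 0) ⌈ val c i k /2⌉ (suc t))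
... | no nl  rewrite at-tabulateOn c (Ωcell n m c) i k | ¬InShape⇒at c nl = Bool.∧-zeroʳ _

tileAt : GDA → ℕ → ℕ → Tile × ℕ
tileAt = atOr (sq , 0)

labelAt : GDA → ℕ → ℕ → ℕ
labelAt g i j = proj₂ (tileAt g i j)

horizontalRank : GDA → ℕ → ℕ → ℕ → ℕ
horizontalRank g i s j = countBelow (λ k → horizontalLabelled (at g i k) s) j

horizontalHalf : GDA → ℕ → ℕ → ℕ
horizontalHalf g i s = ⌊ horizontalRank g i s (rowLength g i) /2⌋

unfoldTile : Tile × ℕ → ℕ → ℕ → ℕ
unfoldTile (vT , s) rank half = s + s
unfoldTile (vB , s) rank half = pred (s + s)
unfoldTile (sq , s) rank half = pred (s + s)
unfoldTile (hL , s) rank half = if rank <ᵇ half then s + s else pred (s + s)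
unfoldTile (hR , s) rank half = if rank <ᵇ half then s + s else pred (s + s)

Ψcell : GDA → ℕ → ℕ → ℕ
Ψcell g i j = unfoldTile (tileAt g i j) (horizontalRank g i (labelAt g i j) j) (horizontalHalf g i (labelAt g i j))

Ψ : GDA → PP
Ψ g = tabulateOn g (Ψcell g)

Ψcell-at : ∀ {g i j T t} → at g i j ≡ just (T , suc t) →
           Ψcell g i j ≡ unfoldTile (T , suc t) (horizontalRank g i (suc t) j) (horizontalHalf g i (suc t))
Ψcell-at {g} e rewrite at⇒atOr (sq , 0) g e = refl

suc+suc≡hi : ∀ t → suc t + suc t ≡ hi t
suc+suc≡hi t = cong suc (+-suc t t)

pred[suc+suc]≡lo : ∀ t → pred (suc t + suc t) ≡ lo t
pred[suc+suc]≡lo t = +-suc t t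

data Horizontal : Tile → Set where
  isL : Horizontal hL
  isR : Horizontal hR

Horizontal⇒≢vT : ∀ {T} → Horizontal T → T ≢ vT
Horizontal⇒≢vT isL ()
Horizontal⇒≢vT isR ()

Horizontal⇒≢sq : ∀ {T} → Horizontal T → T ≢ sq
Horizontal⇒≢sq isL ()
Horizontal⇒≢sq isR ()

vT? : (T : Tile) → (T ≡ vT) ⊎ (T ≢ vT)
vT? vT = inj₁ refl
vT? vB = inj₂ λ ()
vT? sq = inj₂ λ ()
vT? hL = inj₂ λ ()
vT? hR = inj₂ λ ()

horizontalLabelled-self : ∀ {T} → Horizontal T → ∀ s → horizontalLabelled (just (T , s)) s ≡ true
horizontalLabelled-self isL s = ≡⇒≡ᵇ-true {s} refl
horizontalLabelled-self isR s = ≡⇒≡ᵇ-true {s} refl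

horizontalLabelled-true : ∀ mx s → horizontalLabelled mx s ≡ true → ∃ λ T → Horizontal T × mx ≡ just (T , s)
horizontalLabelled-true (just (hL , a)) s e = hL , isL , cong (λ a → just (hL , a)) (≡ᵇ-true⇒≡ e)
horizontalLabelled-true (just (hR , a)) s e = hR , isR , cong (λ a → just (hR , a)) (≡ᵇ-true⇒≡ e)

horizontalLabelled-other : ∀ T a s → a ≢ s → horizontalLabelled (just (T , a)) s ≡ false
horizontalLabelled-other vT a s _  = refl
horizontalLabelled-other vB a s _  = refl
horizontalLabelled-other sq a s _  = refl
horizontalLabelled-other hL a s ne = ≢⇒≡ᵇ-false ne
horizontalLabelled-other hR a s ne = ≢⇒≡ᵇ-false ne

unfoldTile-values : ∀ T t rank half → (unfoldTile (T , suc t) rank half ≡ hi t) ⊎ (unfoldTile (T , suc t) rank half ≡ lo t)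
unfoldTile-values vT t _ _ = inj₁ (suc+suc≡hi t)
unfoldTile-values vB t _ _ = inj₂ (pred[suc+suc]≡lo t)
unfoldTile-values sq t _ _ = inj₂ (pred[suc+suc]≡lo t)
unfoldTile-values hL t rank half with rank <ᵇ half
... | true  = inj₁ (suc+suc≡hi t)
... | false = inj₂ (pred[suc+suc]≡lo t)
unfoldTile-values hR t rank half with rank <ᵇ half
... | true  = inj₁ (suc+suc≡hi t)
... | false = inj₂ (pred[suc+suc]≡lo t)

unfoldTile-horizontal : ∀ {T} → Horizontal T → ∀ t rank half →
  unfoldTile (T , suc t) rank half ≡ (if rank <ᵇ half then hi t else lo t)
unfoldTile-horizontal isL t rank half with rank <ᵇ half
... | true  = suc+suc≡hi t
... | false = pred[suc+suc]≡lo t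
unfoldTile-horizontal isR t rank half with rank <ᵇ half
... | true  = suc+suc≡hi t
... | false = pred[suc+suc]≡lo t

unfoldTile-hi⇒< : ∀ {T} → Horizontal T → ∀ t rank half → unfoldTile (T , suc t) rank half ≡ hi t → rank < half
unfoldTile-hi⇒< hor t rank half e with rank <ᵇ half in lt
... | true  = <ᵇ-true⇒< {rank} {half} lt
... | false = ⊥-elim (hi≢lo {t} {t} (trans (sym e) (trans (unfoldTile-horizontal hor t rank half)
                                                          (cong (λ b → if b then hi t else lo t) lt))))

unfoldTile-lo⇒≥ : ∀ {T} → Horizontal T → ∀ t rank half → unfoldTile (T , suc t) rank half ≡ lo t → half ≤ rank
unfoldTile-lo⇒≥ hor t rank half e with rank <ᵇ half in lt
... | false = <ᵇ-false⇒≥ {rank} {half} lt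
... | true  = ⊥-elim (hi≢lo {t} {t} (trans (sym (trans (unfoldTile-horizontal hor t rank half)
                                                          (cong (λ b → if b then hi t else lo t) lt))) e))

leftLabelled : Maybe (Tile × ℕ) → ℕ → Bool
leftLabelled (just (hL , a)) s = a ≡ᵇ s
leftLabelled _               s = false

leftIsHL : GDA → ℕ → ℕ → ℕ → Bool
leftIsHL g i s zero    = false
leftIsHL g i s (suc j) = leftLabelled (at g i j) s

module InG-Properties {n m : ℕ} {g : GDA} (ig : InG n m g) where
  open InG ig

  at≡tileAt : ∀ {i j} → InShape g i j → at g i j ≡ just (tileAt g i j)
  at≡tileAt = at≡atOr (sq , 0) g

  at⇒tileAt : ∀ {i j T a} → at g i j ≡ just (T , a) → tileAt g i j ≡ (T , a)
  at⇒tileAt = at⇒atOr (sq , 0) g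

  at-positive : ∀ {i j} → InShape g i j → ∃ λ T → ∃ λ t → at g i j ≡ just (T , suc t)
  at-positive {i} {j} lt with labelAt g i j in eq
  ... | zero  = ⊥-elim (<-irrefl (sym eq) (positive i j _ _ (at≡tileAt lt)))
  ... | suc t = proj₁ (tileAt g i j) , t , trans (at≡tileAt lt) (cong (λ a → just (proj₁ (tileAt g i j) , a)) eq)

  InShape-up : ∀ {i j} → InShape g (suc i) j → InShape g i j
  InShape-up {i} {j} lt = at⇒InShape g (proj₂ (shape i j _ (at≡tileAt lt)))

  InShape-up* : ∀ {i i′ j} → i ≤ i′ → InShape g i′ j → InShape g i j
  InShape-up* le = go (≤⇒≤′ le)
    where
    go : ∀ {i i′ j} → i ≤′ i′ → InShape g i′ j → InShape g i j
    go ≤′-refl       lt = lt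
    go (≤′-step le′) lt = go le′ (InShape-up lt)

  label-col-step : ∀ {i j} → InShape g (suc i) j → proj₁ (tileAt g i j) ≢ vT → labelAt g (suc i) j < labelAt g i j
  label-col-step {i} {j} lt ne = colStrict i j _ _ _ _ (at≡tileAt (InShape-up lt)) (at≡tileAt lt) ne

  at-vT-below : ∀ {i j} → InShape g i j → proj₁ (tileAt g i j) ≡ vT → at g (suc i) j ≡ just (vB , labelAt g i j)
  at-vT-below {i} {j} lt e = vTbelow i j _ (trans (at≡tileAt lt) (cong (λ T → just (T , labelAt g i j)) e))

  label-col-antitone : ∀ {i i′ j} → i ≤ i′ → InShape g i′ j → labelAt g i′ j ≤ labelAt g i j
  label-col-antitone le = go (≤⇒≤′ le)
    where
    go : ∀ {i i′ j} → i ≤′ i′ → InShape g i′ j → labelAt g i′ j ≤ labelAt g i j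
    go ≤′-refl       _  = ≤-refl
    go {i} {suc i′} {j} (≤′-step le′) lt = ≤-trans (step (vT? (proj₁ (tileAt g i′ j)))) (go le′ (InShape-up lt))
      where
      step : (proj₁ (tileAt g i′ j) ≡ vT) ⊎ (proj₁ (tileAt g i′ j) ≢ vT) → labelAt g (suc i′) j ≤ labelAt g i′ j
      step (inj₁ e)  = ≤-reflexive (cong proj₂ (at⇒tileAt (at-vT-below (InShape-up lt) e)))
      step (inj₂ ne) = <⇒≤ (label-col-step lt ne)

  equal-labels-in-column : ∀ {i i′ j} → i < i′ → InShape g i′ j → labelAt g i j ≡ labelAt g i′ j →
                           proj₁ (tileAt g i j) ≡ vT × i′ ≡ suc i
  equal-labels-in-column {i} {i′} {j} i<i′ lt e with vT? (proj₁ (tileAt g i j))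
  ... | inj₂ ne = ⊥-elim (<⇒≱ (label-col-step (InShape-up* i<i′ lt) ne)
                               (subst (_≤ labelAt g (suc i) j) (sym e) (label-col-antitone i<i′ lt)))
  ... | inj₁ isVT with i′ ≟ suc i
  ...   | yes i′≡ = isVT , i′≡
  ...   | no  i′≢ = ⊥-elim (<⇒≱ (label-col-step (InShape-up* 1+i<i′ lt) (λ q → vB≢vT (trans (sym (cong proj₁ below)) q)))
                                 (subst (_≤ labelAt g (suc (suc i)) j) (trans (sym e) (sym (cong proj₂ below)))
                                        (label-col-antitone 1+i<i′ lt)))
    where
    1+i<i′ = ≤∧≢⇒< i<i′ (i′≢ ∘ sym)
    below = at⇒tileAt (at-vT-below (InShape-up* (<⇒≤ i<i′) lt) isVT)
    vB≢vT : vB ≢ vT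
    vB≢vT ()

  leftIsHL⇒hR : ∀ i s j → leftIsHL g i s j ≡ true → at g i j ≡ just (hR , s)
  leftIsHL⇒hR i s (suc j) e with at g i j in eq
  ... | just (hL , a) = hLright i j s (trans eq (cong (λ a → just (hL , a)) (≡ᵇ-true⇒≡ e)))

  ¬hR⇒leftIsHL-false : ∀ i s j → at g i j ≢ just (hR , s) → leftIsHL g i s j ≡ false
  ¬hR⇒leftIsHL-false i s j ne = Bool.¬-not (ne ∘ leftIsHL⇒hR i s j)

  hR⇒leftIsHL : ∀ i s j → at g i j ≡ just (hR , s) → leftIsHL g i s j ≡ true
  hR⇒leftIsHL i s zero    e = ⊥-elim (hRnot0 i s e)
  hR⇒leftIsHL i s (suc j) e rewrite hRleft i j s e = ≡⇒≡ᵇ-true {s} refl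

  -- Horizontal dominoes labelled s are closed off pairwise from the left.
  horizontalRank-parity : ∀ i s j → (horizontalRank g i s j % 2 ≡ᵇ 0) ≡ not (leftIsHL g i s j)
  horizontalRank-parity i s zero    = refl
  horizontalRank-parity i s (suc j) = trans (parity-step (horizontalRank g i s j) (horizontalLabelled (at g i j) s))
                                            (byTile (at g i j) refl)
    where
    even = horizontalRank g i s j % 2 ≡ᵇ 0
    parity-step : ∀ x b → ((x + (if b then 1 else 0)) % 2 ≡ᵇ 0) ≡ (if b then not (x % 2 ≡ᵇ 0) else (x % 2 ≡ᵇ 0))
    parity-step x false rewrite +-identityʳ x = refl
    parity-step x true  rewrite +-comm x 1 with even-or-odd x
    ... | h , inj₁ e rewrite e | lo%2 h | n+n%2≡0 h = refl
    ... | h , inj₂ e rewrite e | lo%2 h | n+n%2≡0 h = refl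
    evenIfNot-hR : at g i j ≢ just (hR , s) → even ≡ true
    evenIfNot-hR ne = trans (horizontalRank-parity i s j) (cong not (¬hR⇒leftIsHL-false i s j ne))
    other : ∀ {T a} → at g i j ≡ just (T , a) → T ≢ hR → at g i j ≢ just (hR , s)
    other e ne q = ne (cong proj₁ (just-injective (trans (sym e) q)))
    byTile : ∀ mx → at g i j ≡ mx →
             (if horizontalLabelled mx s then not even else even) ≡ not (leftLabelled mx s)
    byTile nothing           e = evenIfNot-hR (λ q → case trans (sym e) q of λ ())
    byTile (just (vT , a))   e = evenIfNot-hR (other e λ ())
    byTile (just (vB , a))   e = evenIfNot-hR (other e λ ())
    byTile (just (sq , a))   e = evenIfNot-hR (other e λ ())
    byTile (just (hL , a))   e with a ≡ᵇ s
    ... | true  rewrite evenIfNot-hR (other e λ ()) = refl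
    ... | false = evenIfNot-hR (other e λ ())
    byTile (just (hR , a))   e with a ≡ᵇ s in a≡s
    ... | false = evenIfNot-hR (λ q → ≡ᵇ-false⇒≢ a≡s (cong proj₂ (just-injective (trans (sym e) q))))
    ... | true rewrite horizontalRank-parity i s j | hR⇒leftIsHL i s j (trans e (cong (λ a → just (hR , a)) (≡ᵇ-true⇒≡ a≡s))) = refl

  hL-rank-even : ∀ {i j s} → at g i j ≡ just (hL , s) → (horizontalRank g i s j % 2 ≡ᵇ 0) ≡ true
  hL-rank-even {i} {j} {s} e = trans (horizontalRank-parity i s j)
    (cong not (¬hR⇒leftIsHL-false i s j λ q → case trans (sym e) q of λ ()))

  hR-rank-odd : ∀ {i j s} → at g i j ≡ just (hR , s) → (horizontalRank g i s j % 2 ≡ᵇ 0) ≡ false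
  hR-rank-odd {i} {j} {s} e = trans (horizontalRank-parity i s j) (cong not (hR⇒leftIsHL i s j e))

  horizontal-total-even : ∀ i s → ∃ λ h → horizontalRank g i s (rowLength g i) ≡ h + h
  horizontal-total-even i s = %2≡ᵇ0⇒even _ (trans (horizontalRank-parity i s (rowLength g i)) (cong not (lastNotHL (rowLength g i) refl)))
    where
    lastNotHL : ∀ N → rowLength g i ≡ N → leftIsHL g i s N ≡ false
    lastNotHL zero    _ = refl
    lastNotHL (suc N) e = ¬hR⇒leftIsHL-false i s (suc N)
      (λ q → <-irrefl refl (subst (suc N <_) e (column< (at⇒InShape g q))))

module Ψ-Properties {n m : ℕ} {g : GDA} (ig : InG n m g) where
  open InG ig
  open InG-Properties ig

  Ψcell-values : ∀ {i j T t} → at g i j ≡ just (T , suc t) → (Ψcell g i j ≡ hi t) ⊎ (Ψcell g i j ≡ lo t)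
  Ψcell-values {T = T} {t} e rewrite Ψcell-at {g} e = unfoldTile-values T t _ _

  Ψcell-label : ∀ {i j T t} → at g i j ≡ just (T , suc t) → ⌈ Ψcell g i j /2⌉ ≡ suc t
  Ψcell-label e = hi⊎lo⇒⌈/2⌉ (Ψcell-values e)

  Ψcell-bounds : ∀ {i j T t} → at g i j ≡ just (T , suc t) → lo t ≤ Ψcell g i j × Ψcell g i j ≤ hi t
  Ψcell-bounds {t = t} e = hi⊎lo⇒lo≤∧≤hi {t} (Ψcell-values e)

  Ψcell-vT : ∀ {i j t} → at g i j ≡ just (vT , suc t) → Ψcell g i j ≡ hi t
  Ψcell-vT {t = t} e = trans (Ψcell-at {g} e) (suc+suc≡hi t)

  Ψcell-lower : ∀ {i j T t} → (T ≡ vB) ⊎ (T ≡ sq) → at g i j ≡ just (T , suc t) → Ψcell g i j ≡ lo t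
  Ψcell-lower {t = t} (inj₁ refl) e = trans (Ψcell-at {g} e) (pred[suc+suc]≡lo t)
  Ψcell-lower {t = t} (inj₂ refl) e = trans (Ψcell-at {g} e) (pred[suc+suc]≡lo t)

  InShape-Ψ : ∀ {i j} → InShape g i j → InShape (Ψ g) i j
  InShape-Ψ = InShape-tabulateOn g (Ψcell g)

  val-Ψ : ∀ {i j} → InShape g i j → val (Ψ g) i j ≡ Ψcell g i j
  val-Ψ = atOr-tabulateOn g (Ψcell g) 0

  colHas-Ψ⇒ : ∀ {j v} → colHas (Ψ g) j v ≡ true → ∃ λ i → InShape g i j × Ψcell g i j ≡ v
  colHas-Ψ⇒ {j} {v} e with colHas⇒val (Ψ g) j v e
  ... | i , lt , q = i , InShape-tabulateOn⁻ g (Ψcell g) lt , trans (sym (val-Ψ (InShape-tabulateOn⁻ g (Ψcell g) lt))) q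

  Ψ⇒colHas : ∀ {i j v} → InShape g i j → Ψcell g i j ≡ v → colHas (Ψ g) j v ≡ true
  Ψ⇒colHas lt e = val⇒colHas (Ψ g) (InShape-Ψ lt) (trans (val-Ψ lt) e)

  ΨpairedAt-vT : ∀ {i j t} → at g i j ≡ just (vT , suc t) → ΩpairedAt (Ψ g) i j ≡ true
  ΨpairedAt-vT {i} {j} {t} e = trans (ΩpairedAt-hi (Ψ g) i j {t} (trans (val-Ψ (at⇒InShape g e)) (Ψcell-vT e)))
                                     (Ψ⇒colHas (at⇒InShape g below) (Ψcell-lower (inj₁ refl) below))
    where below = vTbelow i j (suc t) e

  ΨpairedAt-vB : ∀ {i j t} → at g i j ≡ just (vB , suc t) → ΩpairedAt (Ψ g) i j ≡ true
  ΨpairedAt-vB {zero}  {j} {t} e = ⊥-elim (vBnot0 j (suc t) e)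
  ΨpairedAt-vB {suc i} {j} {t} e = trans (ΩpairedAt-lo (Ψ g) (suc i) j {t} (trans (val-Ψ (at⇒InShape g e)) (Ψcell-lower (inj₁ refl) e)))
                                         (Ψ⇒colHas (at⇒InShape g above) (Ψcell-vT above))
    where above = vBabove i j (suc t) e

  -- A partner of the same label in the column would force a vertical domino.
  ΨpairedAt-other : ∀ {i j T t} → at g i j ≡ just (T , suc t) → T ≢ vT → T ≢ vB → ΩpairedAt (Ψ g) i j ≡ false
  ΨpairedAt-other {i} {j} {T} {t} e T≢vT T≢vB = Bool.¬-not paired
    where
    lt = at⇒InShape g e
    vals = Ψcell-values e
    sameLabel : ∀ {i′ T′ t′} → at g i′ j ≡ just (T′ , suc t′) → Ψcell g i′ j ≡ partner (Ψcell g i j) →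
                labelAt g i j ≡ labelAt g i′ j
    sameLabel e′ v′ = begin
      labelAt g i j                ≡⟨ cong proj₂ (at⇒tileAt e) ⟩
      suc t                        ≡⟨ partner-⌈/2⌉ {t} vals ⟨
      ⌈ partner (Ψcell g i j) /2⌉  ≡⟨ cong ⌈_/2⌉ v′ ⟨
      ⌈ Ψcell g _ j /2⌉            ≡⟨ Ψcell-label e′ ⟩
      _                            ≡⟨ cong proj₂ (at⇒tileAt e′) ⟨
      labelAt g _ j                ∎
      where open ≡-Reasoning
    paired : ΩpairedAt (Ψ g) i j ≢ true
    paired p with colHas-Ψ⇒ (trans (cong (λ v → colHas (Ψ g) j (partner v)) (sym (val-Ψ lt))) p)
    ... | i′ , lt′ , v′ with at-positive lt′
    ...   | T′ , t′ , e′ with <-cmp i i′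
    ...     | tri≈ _ refl _ = partner-≢ {t} vals v′
    ...     | tri< i<i′ _ _ =
      T≢vT (trans (sym (cong proj₁ (at⇒tileAt e))) (proj₁ (equal-labels-in-column i<i′ lt′ (sameLabel e′ v′))))
    ...     | tri> _ _ i′<i with equal-labels-in-column i′<i lt (sym (sameLabel e′ v′))
    ...       | isVT , refl =
      T≢vB (cong proj₁ (trans (sym (at⇒tileAt e)) (at⇒tileAt (at-vT-below (InShape-up lt) isVT))))

  ΨsatAt-sq : ∀ {i j t} → at g i j ≡ just (sq , suc t) → ΩsatAt n m (Ψ g) i j ≡ true
  ΨsatAt-sq {i} {j} {t} e with E3b i j (suc t) e
  ... | odd , label with %2≡1⇒lo odd
  ...   | t′ , b≡lo with suc-injective (trans label (trans (cong ⌈_/2⌉ b≡lo) (⌈lo/2⌉ t′)))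
  ...     | refl = trans (ΩsatAt-lo n m (Ψ g) i j {t} (trans (val-Ψ (at⇒InShape g e)) (Ψcell-lower (inj₂ refl) e)))
                         (≡⇒≡ᵇ-true (trans (cong (suc j +_) (sym b≡lo)) (m+[n∸m]≡n (≤-trans (E1 i j _ e) (m≤m+n n m)))))

  ΨsatAt-horizontal : ∀ {i j T t} → at g i j ≡ just (T , suc t) → Horizontal T → ΩsatAt n m (Ψ g) i j ≡ false
  ΨsatAt-horizontal {i} {j} {T} {t} e hor with Ψcell-values e
  ... | inj₁ v≡hi = ΩsatAt-hi n m (Ψ g) i j {t} (trans (val-Ψ (at⇒InShape g e)) v≡hi)
  ... | inj₂ v≡lo = trans (ΩsatAt-lo n m (Ψ g) i j {t} (trans (val-Ψ (at⇒InShape g e)) v≡lo))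
                          (Bool.¬-not (Horizontal⇒≢sq hor ∘ square))
    where
    square : ((suc j + lo t) ≡ᵇ (n + m)) ≡ true → T ≡ sq
    square q = E3a i j T (suc t) e (trans (cong (_% 2) b≡lo) (lo%2 t)) (sym (trans (cong ⌈_/2⌉ b≡lo) (⌈lo/2⌉ t)))
      where
      b≡lo : n + m ∸ suc j ≡ lo t
      b≡lo = trans (cong (_∸ suc j) (sym (≡ᵇ-true⇒≡ {suc j + lo t} {n + m} q))) (m+n∸m≡n (suc j) (lo t))

  ΨfreeLabelled≡horizontalLabelled : ∀ i t k →
    ΩfreeLabelled n m (Ψ g) i (suc t) k ≡ horizontalLabelled (at g i k) (suc t)
  ΨfreeLabelled≡horizontalLabelled i t k with InShape? g i k
  ... | no nl = trans (ΩfreeLabelled-other {n} {m} {Ψ g} {i} {suc t} {k} (λ q → 0≢1+n (trans (sym outside) q)))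
                      (sym (cong (λ z → horizontalLabelled z (suc t)) (¬InShape⇒at g nl)))
    where
    outside : ⌈ val (Ψ g) i k /2⌉ ≡ 0
    outside = cong (λ z → ⌈ fromMaybe 0 z /2⌉) (¬InShape⇒at (Ψ g) (nl ∘ InShape-tabulateOn⁻ g (Ψcell g)))
  ... | yes lt with at-positive lt
  ...   | T , t′ , e with t′ ≟ t
  ...     | no t′≢t = trans (ΩfreeLabelled-other {n} {m} {Ψ g} {i} {suc t} {k} (t′≢t ∘ suc-injective ∘ trans (sym label)))
                            (sym (trans (cong (λ z → horizontalLabelled z (suc t)) e)
                                        (horizontalLabelled-other T (suc t′) (suc t) (t′≢t ∘ suc-injective))))
    where label = trans (cong ⌈_/2⌉ (val-Ψ lt)) (Ψcell-label e)
  ...     | yes refl = trans (byTile T e) (sym (cong (λ z → horizontalLabelled z (suc t)) e))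
    where
    label = trans (cong ⌈_/2⌉ (val-Ψ lt)) (Ψcell-label e)
    byTile : ∀ T → at g i k ≡ just (T , suc t) → ΩfreeLabelled n m (Ψ g) i (suc t) k ≡ horizontalLabelled (just (T , suc t)) (suc t)
    byTile vT e = ΩfreeLabelled-paired {n} {m} {Ψ g} {i} {suc t} {k} (ΨpairedAt-vT e)
    byTile vB e = ΩfreeLabelled-paired {n} {m} {Ψ g} {i} {suc t} {k} (ΨpairedAt-vB e)
    byTile sq e = ΩfreeLabelled-saturated {n} {m} {Ψ g} {i} {suc t} {k} (ΨsatAt-sq e)
    byTile hL e = trans (ΩfreeLabelled-intro {n} {m} {Ψ g} {i} {suc t} {k} (ΨpairedAt-other e (λ ()) (λ ())) (ΨsatAt-horizontal e isL) label)
                        (sym (horizontalLabelled-self isL (suc t)))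
    byTile hR e = trans (ΩfreeLabelled-intro {n} {m} {Ψ g} {i} {suc t} {k} (ΨpairedAt-other e (λ ()) (λ ())) (ΨsatAt-horizontal e isR) label)
                        (sym (horizontalLabelled-self isR (suc t)))

  Ψ-βfree≡horizontalLabelled : ∀ t i k → βfree n m (hi t) (Ψ g) i k ≡ horizontalLabelled (at g i k) (suc t)
  Ψ-βfree≡horizontalLabelled t i k =
    trans (βfree≡ΩfreeLabelled n m t (Ψ g) i k) (ΨfreeLabelled≡horizontalLabelled i t k)

  Ψ-val-horizontal : ∀ t i k → horizontalLabelled (at g i k) (suc t) ≡ true →
    val (Ψ g) i k ≡ (if horizontalRank g i (suc t) k <ᵇ horizontalHalf g i (suc t) then hi t else lo t)
  Ψ-val-horizontal t i k h with horizontalLabelled-true (at g i k) (suc t) h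
  ... | T , hor , e = trans (val-Ψ (at⇒InShape g e)) (trans (Ψcell-at {g} e) (unfoldTile-horizontal hor t _ _))

  Ψ-βfreeLowerCount : ∀ t i → βfreeLowerCount n m (hi t) (Ψ g) i ≡ horizontalHalf g i (suc t)
  Ψ-βfreeLowerCount t i = begin
    βfreeLowerCount n m (hi t) (Ψ g) i
      ≡⟨ cong (countBelow _) (rowLength-tabulateOn g (Ψcell g) i) ⟩
    countBelow (λ k → βfree n m (hi t) (Ψ g) i k ∧ (val (Ψ g) i k ≡ᵇ lo t)) (rowLength g i)
      ≡⟨ countBelow-cong _ _ (rowLength g i) (λ k _ → trans (cong (_∧ _) (Ψ-βfree≡horizontalLabelled t i k))
           (∧-cong-when-true λ h → trans (cong (_≡ᵇ lo t) (Ψ-val-horizontal t i k h)) (if-hi-lo-≡ᵇlo _ t))) ⟩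
    countBelow (λ k → H k ∧ not (horizontalRank g i (suc t) k <ᵇ half)) (rowLength g i)
      ≡⟨ countBelow-rank≥ H half (rowLength g i) ⟩
    horizontalRank g i (suc t) (rowLength g i) ∸ half
      ≡⟨ cong₂ _∸_ (proj₂ total) half≡h ⟩
    h + h ∸ h
      ≡⟨ m+n∸n≡m h h ⟩
    h
      ≡⟨ half≡h ⟨
    half ∎
    where
    open ≡-Reasoning
    H : ℕ → Bool
    H k = horizontalLabelled (at g i k) (suc t)
    half = horizontalHalf g i (suc t)
    total = horizontal-total-even i (suc t)
    h = proj₁ total
    half≡h : half ≡ h
    half≡h = trans (cong ⌊_/2⌋ (proj₂ total)) (⌊n+n/2⌋≡n h)

  Ψ-FreeSorted : ∀ t → FreeSorted n m (hi t) (Ψ g)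
  Ψ-FreeSorted t i j free = begin
    (val (Ψ g) i j ≡ᵇ hi t)                            ≡⟨ cong (_≡ᵇ hi t) (Ψ-val-horizontal t i j (trans (sym (Ψ-βfree≡horizontalLabelled t i j)) free)) ⟩
    ((if rank <ᵇ half then hi t else lo t) ≡ᵇ hi t)    ≡⟨ if-hi-lo-≡ᵇhi (rank <ᵇ half) t ⟩
    (rank <ᵇ half)                                     ≡⟨ cong₂ _<ᵇ_ (countBelow-cong _ _ j (λ k _ → Ψ-βfree≡horizontalLabelled t i k))
                                                                     (Ψ-βfreeLowerCount t i) ⟨
    (countBelow (βfree n m (hi t) (Ψ g) i) j <ᵇ βfreeLowerCount n m (hi t) (Ψ g) i) ∎
    where
    open ≡-Reasoning
    rank = horizontalRank g i (suc t) j
    half = horizontalHalf g i (suc t)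

  Ψ-ρ̃-fixed : ρ̃ n m (Ψ g) ≡ Ψ g
  Ψ-ρ̃-fixed = FreeSorted⇒ρ̃-fixed n m (Ψ g) Ψ-FreeSorted

  Ω-Ψ : Ω n m (Ψ g) ≡ g
  Ω-Ψ = trans (tabulateOn-tabulateOn g (Ψcell g) (Ωcell n m (Ψ g)))
              (tabulateOn-id (sq , 0) g (Ωcell n m (Ψ g)) λ i j lt → cell lt (at-positive lt))
    where
    cell : ∀ {i j} → InShape g i j → (∃ λ T → ∃ λ t → at g i j ≡ just (T , suc t)) → Ωcell n m (Ψ g) i j ≡ tileAt g i j
    cell {i} {j} lt (T , t , e) = trans (byTile T e) (sym (at⇒tileAt e))
      where
      label : ⌈ val (Ψ g) i j /2⌉ ≡ suc t
      label = trans (cong ⌈_/2⌉ (val-Ψ lt)) (Ψcell-label e)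
      rank : ΩhorizontalRank n m (Ψ g) i j ≡ horizontalRank g i (suc t) j
      rank = trans (ΩhorizontalRank-label {n} {m} {Ψ g} {i} {j} label)
                   (countBelow-cong _ _ j (λ k _ → ΨfreeLabelled≡horizontalLabelled i t k))
      evenness : ∀ {v} → Ψcell g i j ≡ v → (val (Ψ g) i j % 2 ≡ᵇ 0) ≡ (v % 2 ≡ᵇ 0)
      evenness q = cong (λ v → v % 2 ≡ᵇ 0) (trans (val-Ψ lt) q)
      byTile : ∀ T → at g i j ≡ just (T , suc t) → Ωcell n m (Ψ g) i j ≡ (T , suc t)
      byTile vT e = Ωcell-from {n} {m} {Ψ g} {i} {j} (ΨpairedAt-vT e)
                      (trans (evenness (Ψcell-vT e)) (cong (_≡ᵇ 0) (hi%2 t))) refl refl label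
      byTile vB e = Ωcell-from {n} {m} {Ψ g} {i} {j} (ΨpairedAt-vB e)
                      (trans (evenness (Ψcell-lower (inj₁ refl) e)) (cong (_≡ᵇ 0) (lo%2 t))) refl refl label
      byTile sq e = Ωcell-from {n} {m} {Ψ g} {i} {j} (ΨpairedAt-other e (λ ()) (λ ())) refl (ΨsatAt-sq e) refl label
      byTile hL e = Ωcell-from {n} {m} {Ψ g} {i} {j} (ΨpairedAt-other e (λ ()) (λ ())) refl (ΨsatAt-horizontal e isL)
                      (trans (cong (λ r → r % 2 ≡ᵇ 0) rank) (hL-rank-even e)) label
      byTile hR e = Ωcell-from {n} {m} {Ψ g} {i} {j} (ΨpairedAt-other e (λ ()) (λ ())) refl (ΨsatAt-horizontal e isR)
                      (trans (cong (λ r → r % 2 ≡ᵇ 0) rank) (hR-rank-odd e)) label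

  horizontal-no-ascent : ∀ {i j T U t} → Horizontal T → at g i j ≡ just (T , suc t) → at g i (suc j) ≡ just (U , suc t) →
                         Ψcell g i j ≡ lo t → Ψcell g i (suc j) ≢ hi t
  horizontal-no-ascent {i} {j} {T} {U} {t} hor e₁ e₂ x≡lo = byTile U e₂
    where
    half≤rank : horizontalHalf g i (suc t) ≤ horizontalRank g i (suc t) j
    half≤rank = unfoldTile-lo⇒≥ hor t _ _ (trans (sym (Ψcell-at {g} e₁)) x≡lo)
    rank-step : horizontalRank g i (suc t) (suc j) ≡ suc (horizontalRank g i (suc t) j)
    rank-step = countBelow-suc-true _ j (trans (cong (λ z → horizontalLabelled z (suc t)) e₁) (horizontalLabelled-self hor (suc t)))
    past-half : ∀ {U} → Horizontal U → at g i (suc j) ≡ just (U , suc t) → Ψcell g i (suc j) ≢ hi t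
    past-half horU e y≡hi = <⇒≱ (unfoldTile-hi⇒< horU t _ _ (trans (sym (Ψcell-at {g} e)) y≡hi))
                                (≤-trans half≤rank (≤-trans (n≤1+n _) (≤-reflexive (sym rank-step))))
    byTile : ∀ U → at g i (suc j) ≡ just (U , suc t) → Ψcell g i (suc j) ≢ hi t
    byTile vT e _ = <⇒≱ (label-col-step in₁ (λ q → Horizontal⇒≢vT hor (trans (sym (cong proj₁ (at⇒tileAt e₁))) q)))
                        (≤-trans (≤-reflexive (cong proj₂ (at⇒tileAt e₁)))
                                 (rowWeak (suc i) j _ vB _ (suc t) (at≡tileAt in₁) below))
      where
      below = vTbelow i (suc j) (suc t) e
      in₁ = InShape-left g (n≤1+n j) (at⇒InShape g below)
    byTile vB e y≡hi = hi≢lo {t} {t} (trans (sym y≡hi) (Ψcell-lower (inj₁ refl) e))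
    byTile sq e y≡hi = hi≢lo {t} {t} (trans (sym y≡hi) (Ψcell-lower (inj₂ refl) e))
    byTile hL e = past-half isL e
    byTile hR e = past-half isR e

  -- Equal labels in a row never read lo t then hi t: that pattern would need a square or a vertical domino
  -- bottom followed by something larger, which (E2)-(E3) and column-strictness exclude.
  no-ascent : ∀ {i j T U t} → at g i j ≡ just (T , suc t) → at g i (suc j) ≡ just (U , suc t) →
              Ψcell g i j ≡ lo t → Ψcell g i (suc j) ≢ hi t
  no-ascent {T = vT} {t = t} e₁ e₂ x≡lo _ = hi≢lo {t} {t} (trans (sym (Ψcell-vT e₁)) x≡lo)
  no-ascent {T = hL} e₁ e₂ = horizontal-no-ascent isL e₁ e₂
  no-ascent {T = hR} e₁ e₂ = horizontal-no-ascent isR e₁ e₂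
  no-ascent {i} {j} {sq} {U} {t} e₁ e₂ _ _ with E3b i j (suc t) e₁
  ... | odd , label with %2≡1⇒lo odd
  ...   | t′ , b≡lo with suc-injective (trans label (trans (cong ⌈_/2⌉ b≡lo) (⌈lo/2⌉ t′)))
  ...     | refl = <-irrefl refl (≤-trans (E2 i (suc j) U (suc t) e₂) (≤-reflexive next-bound))
    where
    next-bound : ⌈ (n + m ∸ suc (suc j)) /2⌉ ≡ t
    next-bound = trans (cong ⌈_/2⌉ (trans (sym (pred[m∸n]≡m∸[1+n] (n + m) (suc j))) (cong pred b≡lo))) (⌈n+n/2⌉≡n t)
  no-ascent {zero}  {j} {vB} {U} {t} e₁ _ _ _ = vBnot0 j (suc t) e₁
  no-ascent {suc i} {j} {vB} {U} {t} e₁ e₂ _ y≡hi with vT? (proj₁ (tileAt g i (suc j)))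
  ... | inj₁ isVT = hi≢lo {t} {t} (trans (sym y≡hi) (Ψcell-lower (inj₁ refl) (trans e₂ (cong (λ U → just (U , suc t)) U≡vB))))
    where
    U≡vB : U ≡ vB
    U≡vB = cong proj₁ (trans (sym (at⇒tileAt e₂)) (at⇒tileAt (at-vT-below in₀ isVT)))
      where in₀ = InShape-up (at⇒InShape g e₂)
  ... | inj₂ notVT = <⇒≱ (label-col-step (at⇒InShape g e₂) notVT)
                          (≤-trans (rowWeak i j vT _ (suc t) _ (vBabove i j (suc t) e₁) (at≡tileAt (InShape-up (at⇒InShape g e₂))))
                                   (≤-reflexive (sym (cong proj₂ (at⇒tileAt e₂)))))

  Ψcell-row : ∀ {i j T U t u} → at g i j ≡ just (T , suc t) → at g i (suc j) ≡ just (U , suc u) →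
              Ψcell g i (suc j) ≤ Ψcell g i j
  Ψcell-row {i} {j} {T} {U} {t} {u} e₁ e₂ with u ≟ t
  ... | no u≢t = ≤-trans (proj₂ (Ψcell-bounds e₂))
                         (≤-trans (<⇒≤ (hi<lo (≤∧≢⇒< (≤-pred (rowWeak i j T U (suc t) (suc u) e₁ e₂)) u≢t)))
                                  (proj₁ (Ψcell-bounds e₁)))
  ... | yes refl with Ψcell-values e₁ | Ψcell-values e₂
  ...   | inj₁ x≡hi | _          = subst (Ψcell g i (suc j) ≤_) (sym x≡hi) (proj₂ (Ψcell-bounds e₂))
  ...   | inj₂ x≡lo | inj₂ y≡lo  = ≤-reflexive (trans y≡lo (sym x≡lo))
  ...   | inj₂ x≡lo | inj₁ y≡hi  = ⊥-elim (no-ascent e₁ e₂ x≡lo y≡hi)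

  Ψcell-col : ∀ {i j T U t u} → at g i j ≡ just (T , suc t) → at g (suc i) j ≡ just (U , suc u) →
              Ψcell g (suc i) j < Ψcell g i j
  Ψcell-col {i} {j} {T} {U} {t} {u} e₁ e₂ with vT? T
  ... | inj₁ refl = subst₂ _<_ (sym (Ψcell-lower (inj₁ refl) (vTbelow i j (suc t) e₁))) (sym (Ψcell-vT e₁)) ≤-refl
  ... | inj₂ T≢vT = ≤-trans (s≤s (proj₂ (Ψcell-bounds e₂)))
                            (≤-trans (hi<lo (≤-pred (colStrict i j T U (suc t) (suc u) e₁ e₂ T≢vT))) (proj₁ (Ψcell-bounds e₁)))

  Ψcell-bound : ∀ {i j T t} → at g i j ≡ just (T , suc t) → Ψcell g i j ≤ n + m ∸ suc j
  Ψcell-bound {i} {j} {T} {t} e = byParity (hiLo (n + m ∸ suc j))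
    where
    label≤ : suc t ≤ ⌈ (n + m ∸ suc j) /2⌉
    label≤ = E2 i j T (suc t) e
    byParity : HiLo (n + m ∸ suc j) → Ψcell g i j ≤ n + m ∸ suc j
    byParity (is-zero b≡0) = ⊥-elim (<⇒≱ (s≤s z≤n) (subst (λ b → suc t ≤ ⌈ b /2⌉) b≡0 label≤))
    byParity (is-hi h b≡hi) = ≤-trans (proj₂ (Ψcell-bounds e))
      (subst (hi t ≤_) (sym b≡hi) (hi-mono (≤-pred (subst (suc t ≤_) (trans (cong ⌈_/2⌉ b≡hi) (⌈hi/2⌉ h)) label≤))))
    byParity (is-lo h b≡lo) with t ≟ h
    ... | no t≢h = ≤-trans (proj₂ (Ψcell-bounds e)) (subst (hi t ≤_) (sym b≡lo)
                    (<⇒≤ (hi<lo (≤∧≢⇒< (≤-pred (subst (suc t ≤_) (trans (cong ⌈_/2⌉ b≡lo) (⌈lo/2⌉ h)) label≤)) t≢h))))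
    ... | yes refl with E3a i j T (suc t) e (trans (cong (_% 2) b≡lo) (lo%2 t)) (sym (trans (cong ⌈_/2⌉ b≡lo) (⌈lo/2⌉ t)))
    ...   | refl = ≤-reflexive (trans (Ψcell-lower (inj₂ refl) e) (sym b≡lo))

  Ψ-InC : InC n m (Ψ g)
  Ψ-InC = record
    { rowsNonempty = tabulateOn-rowsNonempty g (Ψcell g) rowsNonempty
    ; shape        = λ i j x e → InShape⇒at (Ψ g) (InShape-Ψ (InShape-up (proj₁ (at-Ψ⇒ e))))
    ; positive     = λ i j x e → lift₁ e λ e′ → ≤-trans (s≤s z≤n) (proj₁ (Ψcell-bounds e′))
    ; rowWeak      = λ i j x y e₁ e₂ → lift₂ e₁ e₂ Ψcell-row
    ; colStrict    = λ i j x y e₁ e₂ → lift₂ e₁ e₂ Ψcell-col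
    ; columns      = λ i j x e → E1 i j _ (at≡tileAt (proj₁ (at-Ψ⇒ e)))
    ; bound        = λ i j x e → lift₁ e Ψcell-bound }
    where
    at-Ψ⇒ : ∀ {i j x} → at (Ψ g) i j ≡ just x → InShape g i j × Ψcell g i j ≡ x
    at-Ψ⇒ = at-tabulateOn⇒ g (Ψcell g)
    lift₁ : ∀ {i j x} {P : ℕ → Set} → at (Ψ g) i j ≡ just x →
            (∀ {T t} → at g i j ≡ just (T , suc t) → P (Ψcell g i j)) → P x
    lift₁ {P = P} e f with at-Ψ⇒ e
    ... | lt , refl with at-positive lt
    ...   | _ , _ , e′ = f e′
    lift₂ : ∀ {i j i′ j′ x y} {R : ℕ → ℕ → Set} → at (Ψ g) i j ≡ just x → at (Ψ g) i′ j′ ≡ just y →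
            (∀ {T U t u} → at g i j ≡ just (T , suc t) → at g i′ j′ ≡ just (U , suc u) → R (Ψcell g i′ j′) (Ψcell g i j)) →
            R y x
    lift₂ e₁ e₂ f with at-Ψ⇒ e₁ | at-Ψ⇒ e₂
    ... | lt₁ , refl | lt₂ , refl with at-positive lt₁ | at-positive lt₂
    ...   | _ , _ , a₁ | _ , _ , a₂ = f a₁ a₂

module Ω-LeftInverse {n m : ℕ} {c : PP} (ic : InC n m c) (fixed : ρ̃ n m c ≡ c) where
  open InC-Properties ic
  open Ω-Valid ic fixed

  horizontalRank-Ω : ∀ i t j → horizontalRank (Ω n m c) i (suc t) j ≡ countBelow (βfree n m (hi t) c i) j
  horizontalRank-Ω i t j = countBelow-cong _ _ j λ k _ →
    sym (trans (βfree≡ΩfreeLabelled n m t c i k) (ΩfreeLabelled≡horizontalLabelled n m c i t k))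

  horizontalHalf-Ω : ∀ i t → hi t ≤ n + m → horizontalHalf (Ω n m c) i (suc t) ≡ βfreeLowerCount n m (hi t) c i
  horizontalHalf-Ω i t le = trans (cong ⌊_/2⌋ total) (⌊n+n/2⌋≡n _)
    where
    total = trans (cong (horizontalRank (Ω n m c) i (suc t)) (rowLength-tabulateOn c (Ωcell n m c) i))
                  (trans (horizontalRank-Ω i t (rowLength c i))
                         (FreeSorted⇒free-count n m t c i (ρ̃-fixed⇒FreeSorted n m t c fixed le)))

  Ψcell-Ω-horizontal : ∀ {i j T t} → Horizontal T → InShape c i j → ⌈ val c i j /2⌉ ≡ suc t →
                       at (Ω n m c) i j ≡ just (T , suc t) → Ψcell (Ω n m c) i j ≡ val c i j
  Ψcell-Ω-horizontal {i} {j} {T} {t} hor lt la e = begin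
    Ψcell (Ω n m c) i j
      ≡⟨ Ψcell-at {Ω n m c} e ⟩
    unfoldTile (T , suc t) rank half
      ≡⟨ unfoldTile-horizontal hor t rank half ⟩
    (if rank <ᵇ half then hi t else lo t)
      ≡⟨ cong₂ (λ r h → if r <ᵇ h then hi t else lo t) (horizontalRank-Ω i t j) (horizontalHalf-Ω i t (hi≤n+m lt la)) ⟩
    (if countBelow (βfree n m (hi t) c i) j <ᵇ βfreeLowerCount n m (hi t) c i then hi t else lo t)
      ≡⟨ hi⊎lo⇒≡if {t = t} (⌈/2⌉≡suc⇒hi⊎lo la) (ρ̃-fixed⇒FreeSorted n m t c fixed (hi≤n+m lt la) i j free) ⟨
    val c i j ∎
    where
    open ≡-Reasoning
    rank = horizontalRank (Ω n m c) i (suc t) j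
    half = horizontalHalf (Ω n m c) i (suc t)
    free : βfree n m (hi t) c i j ≡ true
    free = trans (βfree≡ΩfreeLabelled n m t c i j)
                 (trans (ΩfreeLabelled≡horizontalLabelled n m c i t j)
                        (trans (cong (λ z → horizontalLabelled z (suc t)) e) (horizontalLabelled-self hor (suc t))))

  Ψcell-Ω : ∀ {i j} → InShape c i j → Ψcell (Ω n m c) i j ≡ val c i j
  Ψcell-Ω {i} {j} lt with label-positive lt | Ω-spec n m c (Ω-InShape n m c lt)
  ... | t , la | _ , la′ , spec = byTile (proj₁ (Ωcell n m c i j)) spec
        (trans (Ω-InShape n m c lt) (cong (λ a → just (proj₁ (Ωcell n m c i j) , a)) (trans (sym la′) la)))
    where
    v = val c i j
    values = ⌈/2⌉≡suc⇒hi⊎lo la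
    byTile : ∀ T → TileSpec T (ΩpairedAt c i j) (v % 2 ≡ᵇ 0) (ΩsatAt n m c i j) (ΩhorizontalRank n m c i j % 2 ≡ᵇ 0) →
             at (Ω n m c) i j ≡ just (T , suc t) → Ψcell (Ω n m c) i j ≡ v
    byTile vT (_ , even) e = trans (Ψcell-at {Ω n m c} e) (trans (suc+suc≡hi t) (sym (hi⊎lo-even {t = t} values even)))
    byTile vB (_ , odd)  e = trans (Ψcell-at {Ω n m c} e) (trans (pred[suc+suc]≡lo t) (sym (hi⊎lo-odd {t = t} values odd)))
    byTile sq (_ , sat)  e = trans (Ψcell-at {Ω n m c} e)
                               (trans (pred[suc+suc]≡lo t) (sym (hi⊎lo-odd {t = t} values (%2≡ᵇ1⇒%2≢ᵇ0 v (∧-true₁ sat)))))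
    byTile hL _ e = Ψcell-Ω-horizontal isL lt la e
    byTile hR _ e = Ψcell-Ω-horizontal isR lt la e

  Ψ-Ω : Ψ (Ω n m c) ≡ c
  Ψ-Ω = trans (tabulateOn-tabulateOn c (Ωcell n m c) (Ψcell (Ω n m c)))
              (tabulateOn-id 0 c (Ψcell (Ω n m c)) λ i j → Ψcell-Ω)

Ω-injective : ∀ {n m c c′} → InC n m c → ρ̃ n m c ≡ c → InC n m c′ → ρ̃ n m c′ ≡ c′ → Ω n m c ≡ Ω n m c′ → c ≡ c′
Ω-injective {n} {m} {c} {c′} ic fixed ic′ fixed′ eq = begin
  c               ≡⟨ Ω-LeftInverse.Ψ-Ω ic fixed ⟨
  Ψ (Ω n m c)     ≡⟨ cong Ψ eq ⟩
  Ψ (Ω n m c′)    ≡⟨ Ω-LeftInverse.Ψ-Ω ic′ fixed′ ⟩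
  c′              ∎
  where open ≡-Reasoning

mainTheorem4 : (m n : ℕ) → 1 ≤ n →
    ((c : PP) → InC n m c → ρ̃ n m c ≡ c → InG n m (Ω n m c))
    × ((c c′ : PP) → InC n m c → ρ̃ n m c ≡ c → InC n m c′ → ρ̃ n m c′ ≡ c′ →
        Ω n m c ≡ Ω n m c′ → c ≡ c′)
    × ((g : GDA) → InG n m g →
        Σ PP (λ c → InC n m c × ρ̃ n m c ≡ c × Ω n m c ≡ g))
mainTheorem4 m n _ =
  (λ c ic fixed → Ω-Valid.Ω-InG ic fixed) ,
  (λ c c′ → Ω-injective) ,
  (λ g ig → Ψ g , Ψ-InC ig , Ψ-ρ̃-fixed ig , Ω-Ψ ig)
  where open Ψ-Properties
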